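{- For $n\geqslant 1$ let $P_n(q,x,y)=\sum_{\pi\in\mathfrak{S}_n}q^{\operatorname{cpk}(\pi)}x^{\operatorname{cyc}(\pi)}y^{\operatorname{fix}(\pi)}$. Then for $n\geqslant 1$, \begin{align*} P_{n+1}(q,x,y)&=(nq+xy) P_n(q,x,y)+2q(1-q)\frac{\partial P_n(q,x,y)}{\partial q}+x(1-q)\frac{\partial P_n(q,x,y)}{\partial x}\\ &\quad+(1-y)\frac{\partial P_n(q,x,y)}{\partial y}. \end{align*} In particular, $$P_{n+1}(q,x,1)=(nq+x) P_n(q,x,1)+2q(1-q)\frac{\partial P_n(q,x,1)}{\partial q}+x(1-q)\frac{\partial P_n(q,x,1)}{\partial x}.$$
   Context: $\mathfrak{S}_n$ is the set of permutations of $[n]=\{1,\dots,n\}$. Every permutation is written in standard cycle decomposition: each cycle is written with its smallest entry first, and cycles are listed in increasing order of their smallest entries. For a cycle $(c_1,\dots,c_\ell)$ so written, an entry $c_m$ with $2\leqslant m\leqslant \ell-1$ is a cyclic peak if $c_{m-1}<c_m>c_{m+1}$. $\operatorname{cpk}(\pi)$ is the total number of cyclic peaks over all cycles of $\pi$, $\operatorname{cyc}(\pi)$ the number of cycles, and $\operatorname{fix}(\pi)$ the number of fixed points of $\pi$. -}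

module Defs where

open import Data.Bool using (Bool; true; false; _∧_; if_then_else_)
open import Data.Nat as ℕ using (ℕ; zero; suc; _≡ᵇ_; _<ᵇ_; _≤ᵇ_)
open import Data.List using (List; []; _∷_; map; concatMap; length; applyUpTo; filterᵇ; foldr)
open import Data.Integer as ℤ using (ℤ; +_; _+_; _*_; _-_)

-- Permutations of [n] = {1,…,n}, in one-line notation:
-- the list [π(1), …, π(n)].

insertAll : ℕ → List ℕ → List (List ℕ)
insertAll x []       = (x ∷ []) ∷ []
insertAll x (y ∷ ys) = (x ∷ y ∷ ys) ∷ map (y ∷_) (insertAll x ys)

perms : ℕ → List (List ℕ)
perms zero    = [] ∷ []
perms (suc n) = concatMap (insertAll (suc n)) (perms n)

-- π(i) for a permutation given in one-line notation (1-indexed).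
app : List ℕ → ℕ → ℕ
app []       _             = 0
app (x ∷ xs) zero          = 0
app (x ∷ xs) (suc zero)    = x
app (x ∷ xs) (suc (suc k)) = app xs (suc k)

oneTo : ℕ → List ℕ
oneTo n = applyUpTo suc n

orbitFrom : ℕ → List ℕ → ℕ → ℕ → List ℕ
orbitFrom zero     π i j = []
orbitFrom (suc f)  π i j = if j ≡ᵇ i then [] else (j ∷ orbitFrom f π i (app π j))

cycleOf : List ℕ → ℕ → List ℕ
cycleOf π i = i ∷ orbitFrom (length π) π i (app π i)

allᵇ : (ℕ → Bool) → List ℕ → Bool
allᵇ p = foldr (λ x b → p x ∧ b) true

isCycleMin : List ℕ → ℕ → Bool
isCycleMin π i = allᵇ (λ j → i ≤ᵇ j) (cycleOf π i)

cycles : List ℕ → List (List ℕ)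
cycles π = map (cycleOf π) (filterᵇ (isCycleMin π) (oneTo (length π)))

peaksCycle : List ℕ → ℕ
peaksCycle (a ∷ b ∷ c ∷ rest) =
  (if (a <ᵇ b) ∧ (c <ᵇ b) then 1 else 0) ℕ.+ peaksCycle (b ∷ c ∷ rest)
peaksCycle _ = 0

sumℕ : List ℕ → ℕ
sumℕ = foldr ℕ._+_ 0

cpk : List ℕ → ℕ
cpk π = sumℕ (map peaksCycle (cycles π))

cyc : List ℕ → ℕ
cyc π = length (cycles π)

fix : List ℕ → ℕ
fix π = length (filterᵇ (λ i → app π i ≡ᵇ i) (oneTo (length π)))

-- Polynomials with integer coefficients, represented by their
-- coefficient functions.  Poly3 p a b c = coefficient of q^a x^b y^c;
-- Poly2 p a b = coefficient of q^a x^b.  Equality of polynomials is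
-- pointwise equality of coefficients.

Poly3 : Set
Poly3 = ℕ → ℕ → ℕ → ℤ

Poly2 : Set
Poly2 = ℕ → ℕ → ℤ

countᵇ : {A : Set} → (A → Bool) → List A → ℕ
countᵇ p xs = length (filterᵇ p xs)

P : ℕ → Poly3
P n a b c = + countᵇ (λ π → (cpk π ≡ᵇ a) ∧ ((cyc π ≡ᵇ b) ∧ (fix π ≡ᵇ c))) (perms n)

_⊕_ : Poly3 → Poly3 → Poly3
(f ⊕ g) a b c = f a b c + g a b c

_⊖_ : Poly3 → Poly3 → Poly3
(f ⊖ g) a b c = f a b c - g a b c

_·_ : ℤ → Poly3 → Poly3
(k · f) a b c = k * f a b c

mulQ mulX mulY : Poly3 → Poly3
mulQ f zero    b c = + 0
mulQ f (suc a) b c = f a b c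
mulX f a zero    c = + 0
mulX f a (suc b) c = f a b c
mulY f a b zero    = + 0
mulY f a b (suc c) = f a b c

∂q ∂x ∂y : Poly3 → Poly3
∂q f a b c = + suc a * f (suc a) b c
∂x f a b c = + suc b * f a (suc b) c
∂y f a b c = + suc c * f a b (suc c)

_⊕₂_ : Poly2 → Poly2 → Poly2
(f ⊕₂ g) a b = f a b + g a b

_⊖₂_ : Poly2 → Poly2 → Poly2
(f ⊖₂ g) a b = f a b - g a b

_·₂_ : ℤ → Poly2 → Poly2
(k ·₂ f) a b = k * f a b

mulQ₂ mulX₂ : Poly2 → Poly2
mulQ₂ f zero    b = + 0
mulQ₂ f (suc a) b = f a b
mulX₂ f a zero    = + 0
mulX₂ f a (suc b) = f a b

∂q₂ ∂x₂ : Poly2 → Poly2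
∂q₂ f a b = + suc a * f (suc a) b
∂x₂ f a b = + suc b * f a (suc b)

-- substitution y = 1 in a polynomial whose y-degree is at most d
sumTo : ℕ → (ℕ → ℤ) → ℤ
sumTo zero    g = g 0
sumTo (suc d) g = sumTo d g + g (suc d)

evalY1 : ℕ → Poly3 → Poly2
evalY1 d f a b = sumTo d (f a b)

-- P_n(q,x,1); the y-degree of P_n is at most n since fix(π) ≤ n
P1 : ℕ → Poly2
P1 n = evalY1 n (P n)

RHS3 : ℕ → Poly3 → Poly3
RHS3 n f =
  ((((+ n) · mulQ f) ⊕ mulX (mulY f))
   ⊕ ((+ 2) · (mulQ (∂q f) ⊖ mulQ (mulQ (∂q f)))))
  ⊕ ((mulX (∂x f) ⊖ mulQ (mulX (∂x f)))
   ⊕ (∂y f ⊖ mulY (∂y f)))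

RHS2 : ℕ → Poly2 → Poly2
RHS2 n f =
  ((((+ n) ·₂ mulQ₂ f) ⊕₂ mulX₂ f)
   ⊕₂ ((+ 2) ·₂ (mulQ₂ (∂q₂ f) ⊖₂ mulQ₂ (mulQ₂ (∂q₂ f)))))
  ⊕₂ (mulX₂ (∂x₂ f) ⊖₂ mulQ₂ (mulX₂ (∂x₂ f)))

-- Every σ ∈ 𝔖ₙ₊₁ arises from exactly one π ∈ 𝔖ₙ, either by appending n+1 as a fixed point
-- or by splicing n+1 into a cycle of π right after some i ∈ [n].  Appending adds a cycle and
-- a fixed point.  Splicing keeps the cycles, destroys the fixed point i if π(i) = i, and,
-- since n+1 exceeds every other entry, raises cpk by 0 or 1.  Summing the peaks over all
-- splicings into a cycle C shows that exactly |C| − 2 pk(C) − 1 positions raise it, so the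
-- number D of raising positions satisfies D + cyc π + 2 cpk π = n.  Hence π contributes
--   f q^k x^c y^(f−1) + D q^(k+1) x^c y^f + (n − f − D) q^k x^c y^f + q^k x^(c+1) y^(f+1)
-- (k = cpk π, c = cyc π, f = fix π) to P_{n+1}, which is exactly what the differential
-- operator makes of q^k x^c y^f; linearity gives the recurrence.  For y = 1 the same
-- computation runs with the y-exponent summed out.

module Submission where

open import Defs
open import Data.Bool using (Bool; true; false; _∧_; if_then_else_; not; T)
open import Data.Unit using (tt)
open import Data.Empty using (⊥; ⊥-elim)
open import Data.Nat as ℕ using (ℕ; zero; suc; _≤_; _<_; _≥_; s≤s; z≤n; _≡ᵇ_; _<ᵇ_; _≤ᵇ_; _∸_; _⊓_)
import Data.Nat.Properties as NP
open import Data.Nat.ListAction.Properties using (sum-++)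
import Data.Nat.Tactic.RingSolver as NS
open import Data.List using (List; []; _∷_; [_]; _++_; map; concat; concatMap; length; applyUpTo; filterᵇ; foldr)
import Data.List.Properties as LP
open import Data.List.Membership.Propositional using (_∈_; _∉_; lose; find)
open import Data.List.Membership.Propositional.Properties using (∈-∃++; ∈-applyUpTo⁺; ∈-applyUpTo⁻; ∈-concatMap⁺; ∈-concatMap⁻; ∈-map⁺; ∈-map⁻; ∈-++⁺ˡ; ∈-++⁺ʳ; ∈-++⁻; ∈-concat⁺′; ∈-concat⁻′)
open import Data.List.Membership.Propositional.Properties.WithK using (unique∧set⇒bag)
open import Data.List.Membership.DecPropositional ℕ._≟_ using (_∈?_)
open import Data.List.Relation.Binary.BagAndSetEquality using (∼bag⇒↭)
open import Data.List.Relation.Unary.Any using (Any; here; there)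
open import Data.List.Relation.Unary.All as All using (All; []; _∷_)
open import Data.List.Relation.Unary.All.Properties as AllP using (¬Any⇒All¬)
open import Data.List.Relation.Unary.AllPairs using (AllPairs; []; _∷_)
import Data.List.Relation.Unary.AllPairs.Properties as APP
open import Data.List.Relation.Unary.Unique.Propositional using (Unique)
import Data.List.Relation.Unary.Unique.Propositional.Properties as UP
open import Data.List.Relation.Binary.Disjoint.Propositional using (Disjoint)
open import Data.List.Relation.Binary.Permutation.Propositional using (_↭_; ↭-refl; ↭-sym; ↭-trans; prep; swap; ↭⇒↭ₛ)
import Data.List.Relation.Binary.Permutation.Setoid.Properties as ↭ₛ
open import Data.List.Relation.Binary.Permutation.Propositional.Properties using (shift; drop-mid; ↭-empty-inv; ∈-resp-↭; ++-comm; ↭-length; All-resp-↭; ↭-singleton-inv; filter-↭) renaming (map⁺ to ↭-map⁺)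
open import Data.Product using (∃; ∃₂; _×_; _,_; proj₁; proj₂; map₁)
open import Data.Sum using (_⊎_; inj₁; inj₂)
open import Function.Bundles using (mk⇔)
open import Relation.Nullary using (¬_; yes; no)
open import Relation.Nullary.Decidable using (T?)
open import Function using (_∘_; id)
open import Relation.Binary.PropositionalEquality using (_≡_; _≢_; refl; sym; trans; cong; cong₂; subst; setoid)
open import Relation.Binary.PropositionalEquality.Properties using (module ≡-Reasoning)
open ≡-Reasoning

module Combinatorics where

  open import Data.Nat using (_+_; _*_)

  sameElements⇒↭ : ∀ {A : Set} {xs ys : List A} → Unique xs → Unique ys → (∀ {z} → z ∈ xs → z ∈ ys) → (∀ {z} → z ∈ ys → z ∈ xs) → xs ↭ ys
  sameElements⇒↭ ux uy f g = ∼bag⇒↭ (unique∧set⇒bag ux uy (mk⇔ f g))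

  Perm : ℕ → List ℕ → Set
  Perm n π = π ↭ oneTo n

  oneTo-suc : ∀ n → oneTo (suc n) ≡ oneTo n ++ [ suc n ]
  oneTo-suc n = sym (LP.applyUpTo-∷ʳ suc n)

  ∈oneTo⁻ : ∀ {n x} → x ∈ oneTo n → 1 ≤ x × x ≤ n
  ∈oneTo⁻ {n} x∈ with ∈-applyUpTo⁻ suc x∈
  ... | i , i<n , refl = s≤s z≤n , i<n

  ∈oneTo⁺ : ∀ {n x} → 1 ≤ x → x ≤ n → x ∈ oneTo n
  ∈oneTo⁺ {n} {suc x} (s≤s _) x≤n = ∈-applyUpTo⁺ suc x≤n

  oneTo-unique : ∀ n → Unique (oneTo n)
  oneTo-unique n = UP.applyUpTo⁺₁ suc n (λ i<j _ eq → NP.<⇒≢ i<j (NP.suc-injective eq))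

  insAt : ℕ → ℕ → List ℕ → List ℕ
  insAt zero    x ys       = x ∷ ys
  insAt (suc p) x []       = x ∷ []
  insAt (suc p) x (y ∷ ys) = y ∷ insAt p x ys

  insertAll≡insAt : ∀ x π → insertAll x π ≡ applyUpTo (λ p → insAt p x π) (suc (length π))
  insertAll≡insAt x [] = refl
  insertAll≡insAt x (y ∷ ys) = cong ((x ∷ y ∷ ys) ∷_)
    (trans (cong (map (y ∷_)) (insertAll≡insAt x ys)) (LP.map-applyUpTo (λ p → insAt p x ys) (y ∷_) (suc (length ys))))

  insertAll-∈⁻ : ∀ x π {σ} → σ ∈ insertAll x π → ∃₂ λ A B → π ≡ A ++ B × σ ≡ A ++ x ∷ B
  insertAll-∈⁻ x [] (here refl) = [] , [] , refl , refl
  insertAll-∈⁻ x (y ∷ ys) (here refl) = [] , y ∷ ys , refl , refl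
  insertAll-∈⁻ x (y ∷ ys) (there m) with ∈-map⁻ (y ∷_) m
  ... | τ , τ∈ , refl with insertAll-∈⁻ x ys τ∈
  ... | A , B , refl , refl = y ∷ A , B , refl , refl

  insertAll-∈⁺ : ∀ x A B → A ++ x ∷ B ∈ insertAll x (A ++ B)
  insertAll-∈⁺ x [] [] = here refl
  insertAll-∈⁺ x [] (b ∷ B) = here refl
  insertAll-∈⁺ x (a ∷ A) B = there (∈-map⁺ (_ ∷_) (insertAll-∈⁺ x A B))

  perms-sound : ∀ n {σ} → σ ∈ perms n → Perm n σ
  perms-sound zero (here refl) = ↭-refl
  perms-sound (suc n) {σ} m with find (∈-concatMap⁻ (insertAll (suc n)) {xs = perms n} m)
  ... | ρ , ρ∈ , σ∈ with insertAll-∈⁻ (suc n) ρ σ∈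
  ... | A , B , refl , refl =
    ↭-trans (shift (suc n) A B)
    (↭-trans (prep (suc n) (perms-sound n ρ∈))
    (subst (suc n ∷ oneTo n ↭_) (sym (oneTo-suc n)) (++-comm [ suc n ] (oneTo n))))

  perms-complete : ∀ n {σ} → Perm n σ → σ ∈ perms n
  perms-complete zero p with ↭-empty-inv p
  ... | refl = here refl
  perms-complete (suc n) {σ} p with ∈-∃++ (∈-resp-↭ (↭-sym p) (∈oneTo⁺ {suc n} {suc n} (s≤s z≤n) NP.≤-refl))
  ... | A , B , refl =
    ∈-concatMap⁺ (insertAll (suc n)) (lose ρ∈ (insertAll-∈⁺ (suc n) A B))
    where
    p' : A ++ [ suc n ] ++ B ↭ oneTo n ++ [ suc n ] ++ []
    p' = subst (λ z → A ++ [ suc n ] ++ B ↭ z) (oneTo-suc n) p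
    ρ∈ : A ++ B ∈ perms n
    ρ∈ = perms-complete n (subst (λ z → A ++ B ↭ z) (LP.++-identityʳ (oneTo n)) (drop-mid A (oneTo n) p'))

  suc∉perm : ∀ n {π} → Perm n π → suc n ∉ π
  suc∉perm n p m with ∈oneTo⁻ (∈-resp-↭ p m)
  ... | _ , le = NP.<-irrefl refl le

  delete : ℕ → List ℕ → List ℕ
  delete x [] = []
  delete x (y ∷ ys) with x ℕ.≟ y
  ... | yes _ = ys
  ... | no _ = y ∷ delete x ys

  delete-insert : ∀ x A B → x ∉ A → delete x (A ++ x ∷ B) ≡ A ++ B
  delete-insert x [] B _ with x ℕ.≟ x
  ... | yes _ = refl
  ... | no ne = ⊥-elim (ne refl)
  delete-insert x (a ∷ A) B x∉ with x ℕ.≟ a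
  ... | yes refl = ⊥-elim (x∉ (here refl))
  ... | no _ = cong (a ∷_) (delete-insert x A B (λ m → x∉ (there m)))

  ∉++ˡ : ∀ {x : ℕ} A {B} → x ∉ A ++ B → x ∉ A
  ∉++ˡ A h m = h (∈-++⁺ˡ m)

  insertAll-unique : ∀ x π → x ∉ π → Unique (insertAll x π)
  insertAll-unique x [] _ = [] ∷ []
  insertAll-unique x (y ∷ ys) x∉ =
    ¬Any⇒All¬ _ x∉tail ∷ UP.map⁺ (λ { refl → refl }) (insertAll-unique x ys (λ m → x∉ (there m)))
    where
    x∉tail : ¬ Any (_≡_ (x ∷ y ∷ ys)) (map (y ∷_) (insertAll x ys))
    x∉tail m with ∈-map⁻ (y ∷_) m
    ... | τ , _ , eq = x∉ (here (LP.∷-injectiveˡ eq))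

  insertAll-disjoint : ∀ n {ρ₁ ρ₂} → Perm n ρ₁ → Perm n ρ₂ → ρ₁ ≢ ρ₂ → Disjoint (insertAll (suc n) ρ₁) (insertAll (suc n) ρ₂)
  insertAll-disjoint n {ρ₁} {ρ₂} p₁ p₂ ne (m₁ , m₂) with insertAll-∈⁻ (suc n) ρ₁ m₁ | insertAll-∈⁻ (suc n) ρ₂ m₂
  ... | A₁ , B₁ , refl , refl | A₂ , B₂ , refl , eq =
    ne (trans (sym (delete-insert (suc n) A₁ B₁ (∉++ˡ A₁ (suc∉perm n p₁))))
       (trans (cong (delete (suc n)) eq) (delete-insert (suc n) A₂ B₂ (∉++ˡ A₂ (suc∉perm n p₂)))))

  perms-unique : ∀ n → Unique (perms n)
  perms-unique zero = [] ∷ []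
  perms-unique (suc n) = UP.concat⁺ (all-unique (perms n) (λ m → perms-sound n m))
    (APP.map⁺ (pairwise-disjoint (perms n) (perms-unique n) (λ m → perms-sound n m)))
    where
    all-unique : ∀ L → (∀ {ρ} → ρ ∈ L → Perm n ρ) → All Unique (map (insertAll (suc n)) L)
    all-unique [] _ = []
    all-unique (ρ ∷ L) h = insertAll-unique (suc n) ρ (suc∉perm n (h (here refl))) ∷ all-unique L (λ m → h (there m))
    pairwise-disjoint : ∀ L → Unique L → (∀ {ρ} → ρ ∈ L → Perm n ρ) → AllPairs (λ a b → Disjoint (insertAll (suc n) a) (insertAll (suc n) b)) L
    pairwise-disjoint [] _ _ = []
    pairwise-disjoint (ρ ∷ L) (r ∷ u) h = disjoint-from L r (λ m → h (there m)) ∷ pairwise-disjoint L u (λ m → h (there m))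
      where
      disjoint-from : ∀ K → All (ρ ≢_) K → (∀ {τ} → τ ∈ K → Perm n τ) → All (λ b → Disjoint (insertAll (suc n) ρ) (insertAll (suc n) b)) K
      disjoint-from [] _ _ = []
      disjoint-from (τ ∷ K) (ne ∷ ns) h' = insertAll-disjoint n (h (here refl)) (h' (here refl)) ne ∷ disjoint-from K ns (λ m → h' (there m))

  getAt : ℕ → List ℕ → ℕ
  getAt p xs = app xs (suc p)

  setAt : ℕ → ℕ → List ℕ → List ℕ
  setAt _ x [] = []
  setAt zero x (y ∷ ys) = x ∷ ys
  setAt (suc p) x (y ∷ ys) = y ∷ setAt p x ys

  removeAt : ℕ → List ℕ → List ℕ
  removeAt _ [] = []
  removeAt zero (y ∷ ys) = ys
  removeAt (suc p) (y ∷ ys) = y ∷ removeAt p ys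

  lastD : List ℕ → ℕ
  lastD [] = 0
  lastD (x ∷ []) = x
  lastD (x ∷ y ∷ ys) = lastD (y ∷ ys)

  initL : List ℕ → List ℕ
  initL [] = []
  initL (x ∷ []) = []
  initL (x ∷ y ∷ ys) = x ∷ initL (y ∷ ys)

  -- One-line notation, positions counted from 0: spliceAfter p x ρ sends p + 1 ↦ x ↦ ρ (p + 1),
  -- i.e. it splices x into the cycle of p + 1 right after p + 1.
  spliceAfter : ℕ → ℕ → List ℕ → List ℕ
  spliceAfter p x ρ = setAt p x ρ ++ [ getAt p ρ ]

  lastTo : ℕ → List ℕ → List ℕ
  lastTo p π = insAt p (lastD π) (initL π)

  toLast : ℕ → List ℕ → List ℕ
  toLast p ρ = removeAt p ρ ++ [ getAt p ρ ]

  initL-snoc : ∀ ys (z : ℕ) → initL (ys ++ [ z ]) ≡ ys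
  initL-snoc [] z = refl
  initL-snoc (y ∷ []) z = refl
  initL-snoc (y ∷ y' ∷ ys) z = cong (y ∷_) (initL-snoc (y' ∷ ys) z)

  lastD-snoc : ∀ ys (z : ℕ) → lastD (ys ++ [ z ]) ≡ z
  lastD-snoc [] z = refl
  lastD-snoc (y ∷ []) z = refl
  lastD-snoc (y ∷ y' ∷ ys) z = lastD-snoc (y' ∷ ys) z

  init-last : ∀ π → π ≢ [] → initL π ++ [ lastD π ] ≡ π
  init-last [] ne = ⊥-elim (ne refl)
  init-last (x ∷ []) ne = refl
  init-last (x ∷ y ∷ ys) ne = cong (x ∷_) (init-last (y ∷ ys) (λ ()))

  setAt-insAt : ∀ p x z ys → p ≤ length ys → setAt p x (insAt p z ys) ≡ insAt p x ys
  setAt-insAt zero x z ys _ = refl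
  setAt-insAt (suc p) x z (y ∷ ys) (s≤s le) = cong (y ∷_) (setAt-insAt p x z ys le)

  getAt-insAt : ∀ p z ys → p ≤ length ys → getAt p (insAt p z ys) ≡ z
  getAt-insAt zero z ys _ = refl
  getAt-insAt (suc p) z (y ∷ ys) (s≤s le) = getAt-insAt p z ys le

  insAt-snoc : ∀ p x ys z → p ≤ length ys → insAt p x ys ++ [ z ] ≡ insAt p x (ys ++ [ z ])
  insAt-snoc zero x ys z _ = refl
  insAt-snoc (suc p) x (y ∷ ys) z (s≤s le) = cong (y ∷_) (insAt-snoc p x ys z le)

  removeAt-insAt : ∀ p z ys → p ≤ length ys → removeAt p (insAt p z ys) ≡ ys
  removeAt-insAt zero z ys _ = refl
  removeAt-insAt (suc p) z (y ∷ ys) (s≤s le) = cong (y ∷_) (removeAt-insAt p z ys le)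

  insAt-removeAt : ∀ p ρ → p < length ρ → insAt p (getAt p ρ) (removeAt p ρ) ≡ ρ
  insAt-removeAt zero (y ∷ ys) _ = refl
  insAt-removeAt (suc p) (y ∷ ys) (s≤s lt) = cong (y ∷_) (insAt-removeAt p ys lt)

  insAt-↭ : ∀ p x ys → insAt p x ys ↭ x ∷ ys
  insAt-↭ zero x ys = ↭-refl
  insAt-↭ (suc p) x [] = ↭-refl
  insAt-↭ (suc p) x (y ∷ ys) = ↭-trans (prep y (insAt-↭ p x ys)) (swap y x ↭-refl)

  perm-length : ∀ n {π} → Perm n π → length π ≡ n
  perm-length n p = trans (↭-length p) (LP.length-applyUpTo suc n)

  snoc-view : ∀ π → π ≢ [] → ∃₂ λ ys z → π ≡ ys ++ [ z ]
  snoc-view π ne = initL π , lastD π , sym (init-last π ne)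

  -- lastTo p is a bijection of 𝔖ₙ (lastTo-perms), so this turns the one-line insertions
  -- enumerated by perms into cycle insertions.
  insAt≡spliceAfter∘lastTo : ∀ p x π → p < length π → insAt p x π ≡ spliceAfter p x (lastTo p π)
  insAt≡spliceAfter∘lastTo p x π lt with snoc-view π (λ { refl → NP.n≮0 lt })
  ... | ys , z , refl
    rewrite initL-snoc ys z | lastD-snoc ys z | LP.length-++ ys {[ z ]} | NP.+-comm (length ys) 1 =
    let le = NP.≤-pred lt in
    sym (trans (cong₂ (λ a b → a ++ [ b ]) (setAt-insAt p x z ys le) (getAt-insAt p z ys le)) (insAt-snoc p x ys z le))

  lastTo-↭ : ∀ p π → π ≢ [] → lastTo p π ↭ π
  lastTo-↭ p [] ne = ⊥-elim (ne refl)
  lastTo-↭ p (x ∷ xs) _ with snoc-view (x ∷ xs) (λ ())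
  ... | ys , z , eq rewrite eq | initL-snoc ys z | lastD-snoc ys z = ↭-trans (insAt-↭ p z ys) (++-comm [ z ] ys)

  toLast∘lastTo : ∀ p π → p < length π → toLast p (lastTo p π) ≡ π
  toLast∘lastTo p π lt with snoc-view π (λ { refl → NP.n≮0 lt })
  ... | ys , z , refl
    rewrite initL-snoc ys z | lastD-snoc ys z | LP.length-++ ys {[ z ]} | NP.+-comm (length ys) 1 =
    let le = NP.≤-pred lt in
    cong₂ (λ a b → a ++ [ b ]) (removeAt-insAt p z ys le) (getAt-insAt p z ys le)

  lastTo∘toLast : ∀ p ρ → p < length ρ → lastTo p (toLast p ρ) ≡ ρ
  lastTo∘toLast p ρ lt rewrite initL-snoc (removeAt p ρ) (getAt p ρ) | lastD-snoc (removeAt p ρ) (getAt p ρ) = insAt-removeAt p ρ lt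

  toLast-↭ : ∀ p ρ → p < length ρ → toLast p ρ ↭ ρ
  toLast-↭ p ρ lt = subst (λ z → toLast p ρ ↭ z) (insAt-removeAt p ρ lt)
    (↭-trans (↭-sym (++-comm [ getAt p ρ ] (removeAt p ρ))) (↭-sym (insAt-↭ p (getAt p ρ) (removeAt p ρ))))

  unique-map⁺ : ∀ (f : List ℕ → List ℕ) xs → Unique xs → (∀ {a b} → a ∈ xs → b ∈ xs → f a ≡ f b → a ≡ b) → Unique (map f xs)
  unique-map⁺ f [] _ _ = []
  unique-map⁺ f (x ∷ xs) (r ∷ u) inj = images-distinct xs r (λ m → m) ∷ unique-map⁺ f xs u (λ a b → inj (there a) (there b))
    where
    images-distinct : ∀ K → All (x ≢_) K → (∀ {b} → b ∈ K → b ∈ xs) → All (f x ≢_) (map f K)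
    images-distinct [] _ _ = []
    images-distinct (k ∷ K) (ne ∷ ns) sub = (λ eq → ne (inj (here refl) (there (sub (here refl))) eq)) ∷ images-distinct K ns (λ m → sub (there m))

  lastTo-perms : ∀ n p → p < n → map (lastTo p) (perms n) ↭ perms n
  lastTo-perms n p lt = sameElements⇒↭ (unique-map⁺ (lastTo p) (perms n) (perms-unique n) inj) (perms-unique n) fwd bwd
    where
    len : ∀ {π} → π ∈ perms n → p < length π
    len m = subst (p <_) (sym (perm-length n (perms-sound n m))) lt
    inj : ∀ {a b} → a ∈ perms n → b ∈ perms n → lastTo p a ≡ lastTo p b → a ≡ b
    inj {a} {b} ma mb eq = trans (sym (toLast∘lastTo p a (len ma))) (trans (cong (toLast p) eq) (toLast∘lastTo p b (len mb)))
    fwd : ∀ {z} → z ∈ map (lastTo p) (perms n) → z ∈ perms n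
    fwd m with ∈-map⁻ (lastTo p) m
    ... | π , π∈ , refl = perms-complete n (↭-trans (lastTo-↭ p π (λ { refl → NP.n≮0 (len π∈) })) (perms-sound n π∈))
    bwd : ∀ {z} → z ∈ perms n → z ∈ map (lastTo p) (perms n)
    bwd {z} m = subst (_∈ map (lastTo p) (perms n)) (lastTo∘toLast p z (len m))
      (∈-map⁺ (lastTo p) (perms-complete n (↭-trans (toLast-↭ p z (len m)) (perms-sound n m))))

  T→≡ : ∀ {b} → T b → b ≡ true
  T→≡ {true} _ = refl

  ≡→T : ∀ {b} → b ≡ true → T b
  ≡→T refl = tt

  ≡ᵇ-refl : ∀ n → (n ≡ᵇ n) ≡ true
  ≡ᵇ-refl zero = refl
  ≡ᵇ-refl (suc n) = ≡ᵇ-refl n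

  ≢⇒≡ᵇ-false : ∀ {m n} → m ≢ n → (m ≡ᵇ n) ≡ false
  ≢⇒≡ᵇ-false {m} {n} ne with m ≡ᵇ n in eq
  ... | true = ⊥-elim (ne (NP.≡ᵇ⇒≡ m n (≡→T eq)))
  ... | false = refl

  ≡ᵇ-true⇒≡ : ∀ {m n} → (m ≡ᵇ n) ≡ true → m ≡ n
  ≡ᵇ-true⇒≡ {m} {n} e = NP.≡ᵇ⇒≡ m n (≡→T e)

  ≤⇒≤ᵇ-true : ∀ {m n} → m ≤ n → (m ≤ᵇ n) ≡ true
  ≤⇒≤ᵇ-true le = T→≡ (NP.≤⇒≤ᵇ le)

  ≤ᵇ-true⇒≤ : ∀ {m n} → (m ≤ᵇ n) ≡ true → m ≤ n
  ≤ᵇ-true⇒≤ {m} {n} e = NP.≤ᵇ⇒≤ m n (≡→T e)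

  >⇒≤ᵇ-false : ∀ {m n} → n < m → (m ≤ᵇ n) ≡ false
  >⇒≤ᵇ-false {m} {n} lt with m ≤ᵇ n in eq
  ... | true = ⊥-elim (NP.<⇒≱ lt (≤ᵇ-true⇒≤ eq))
  ... | false = refl

  <⇒<ᵇ-true : ∀ {m n} → m < n → (m <ᵇ n) ≡ true
  <⇒<ᵇ-true lt = T→≡ (NP.<⇒<ᵇ lt)

  <ᵇ-true⇒< : ∀ {m n} → (m <ᵇ n) ≡ true → m < n
  <ᵇ-true⇒< {m} {n} e = NP.<ᵇ⇒< m n (≡→T e)

  ≥⇒<ᵇ-false : ∀ {m n} → n ≤ m → (m <ᵇ n) ≡ false
  ≥⇒<ᵇ-false {m} {n} le with m <ᵇ n in eq
  ... | true = ⊥-elim (NP.<⇒≱ (<ᵇ-true⇒< eq) le)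
  ... | false = refl

  ≡ᵇ-false⇒≢ : ∀ {m n} → (m ≡ᵇ n) ≡ false → m ≢ n
  ≡ᵇ-false⇒≢ {m} eq refl with () ← trans (sym (≡ᵇ-refl m)) eq

  ≡ᵇ-suc-shift : ∀ a c s b → a + c ≡ s + b → (a ≡ᵇ suc s) ≡ (b ≡ᵇ suc c)
  ≡ᵇ-suc-shift a c s b e with a ≡ᵇ suc s in e1 | b ≡ᵇ suc c in e2
  ... | true | true = refl
  ... | false | false = refl
  ... | true | false = ⊥-elim (≡ᵇ-false⇒≢ e2 (sym (NP.+-cancelˡ-≡ s (suc c) b (trans (NP.+-suc s c) (trans (cong (λ z → z + c) (sym (≡ᵇ-true⇒≡ e1))) e)))))
  ... | false | true = ⊥-elim (≡ᵇ-false⇒≢ e1 (NP.+-cancelʳ-≡ c a (suc s) (trans e (trans (cong (s +_) (≡ᵇ-true⇒≡ e2)) (NP.+-suc s c)))))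

  Unique-resp-↭ : ∀ {A : Set} {xs ys : List A} → xs ↭ ys → Unique xs → Unique ys
  Unique-resp-↭ {A} p = ↭ₛ.Unique-resp-↭ (setoid A) (↭⇒↭ₛ p)

  unique-++⇒≢ : ∀ (A : List ℕ) {B a b} → Unique (A ++ B) → a ∈ A → b ∈ B → a ≢ b
  unique-++⇒≢ (x ∷ A) (ax ∷ u) (here refl) bB = All.lookup ax (∈-++⁺ʳ A bB)
  unique-++⇒≢ (x ∷ A) (ax ∷ u) (there aA) bB = unique-++⇒≢ A u aA bB

  unique-++ʳ : ∀ (A : List ℕ) {B} → Unique (A ++ B) → Unique B
  unique-++ʳ [] u = u
  unique-++ʳ (x ∷ A) (_ ∷ u) = unique-++ʳ A u

  ∈-dropMiddle : ∀ {x y : ℕ} A {B} → y ∈ A ++ x ∷ B → y ≢ x → y ∈ A ++ B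
  ∈-dropMiddle [] (here refl) ne = ⊥-elim (ne refl)
  ∈-dropMiddle [] (there m) ne = m
  ∈-dropMiddle (a ∷ A) (here refl) ne = here refl
  ∈-dropMiddle (a ∷ A) (there m) ne = there (∈-dropMiddle A m ne)

  unique⊆⇒length≤ : ∀ (xs ys : List ℕ) → Unique xs → (∀ {x} → x ∈ xs → x ∈ ys) → length xs ≤ length ys
  unique⊆⇒length≤ [] ys _ _ = z≤n
  unique⊆⇒length≤ (x ∷ xs) ys (ax ∷ u) sub with ∈-∃++ (sub (here refl))
  ... | A , B , refl = subst (suc (length xs) ≤_) (sym (trans (LP.length-++ A) (NP.+-suc (length A) (length B))))
        (s≤s (subst (length xs ≤_) (LP.length-++ A) (unique⊆⇒length≤ xs (A ++ B) u (λ {y} m → ∈-dropMiddle A (sub (there m)) (λ e → All.lookup ax m (sym e))))))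

  app-∈ : ∀ xs k → k < length xs → app xs (suc k) ∈ xs
  app-∈ (x ∷ xs) zero _ = here refl
  app-∈ (x ∷ xs) (suc k) (s≤s lt) = there (app-∈ xs k lt)

  app-inj : ∀ xs → Unique xs → ∀ k l → k < length xs → l < length xs → app xs (suc k) ≡ app xs (suc l) → k ≡ l
  app-inj (x ∷ xs) u zero zero _ _ _ = refl
  app-inj (x ∷ xs) (ax ∷ u) zero (suc l) _ (s≤s lt) e = ⊥-elim (All.lookup ax (app-∈ xs l lt) e)
  app-inj (x ∷ xs) (ax ∷ u) (suc k) zero (s≤s lt) _ e = ⊥-elim (All.lookup ax (app-∈ xs k lt) (sym e))
  app-inj (x ∷ xs) (ax ∷ u) (suc k) (suc l) (s≤s lk) (s≤s ll) e = cong suc (app-inj xs u k l lk ll e)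

  perm-unique : ∀ n {π} → Perm n π → Unique π
  perm-unique n p = Unique-resp-↭ (↭-sym p) (oneTo-unique n)

  app-∈oneTo : ∀ n {π} → Perm n π → ∀ {x} → x ∈ oneTo n → app π x ∈ oneTo n
  app-∈oneTo n {π} p {x} m with ∈oneTo⁻ m
  ... | s≤s z≤n , le = ∈-resp-↭ p (app-∈ π _ (subst (_ <_) (sym (perm-length n p)) le))

  app-injective : ∀ n {π} → Perm n π → ∀ {x y} → x ∈ oneTo n → y ∈ oneTo n → app π x ≡ app π y → x ≡ y
  app-injective n {π} p {x} {y} mx my e with ∈oneTo⁻ mx | ∈oneTo⁻ my
  ... | s≤s z≤n , lx | s≤s z≤n , ly =
    cong suc (app-inj π (perm-unique n p) _ _ (subst (_ <_) (sym (perm-length n p)) lx) (subst (_ <_) (sym (perm-length n p)) ly) e)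

  data Walk (f : ℕ → ℕ) : ℕ → List ℕ → ℕ → Set where
    wnil  : ∀ {k} → Walk f k [] k
    wcons : ∀ {k L m} → Walk f (f k) L m → Walk f k (k ∷ L) m

  module _ {f : ℕ → ℕ} where

    walk-++ : ∀ {k A m B r} → Walk f k A m → Walk f m B r → Walk f k (A ++ B) r
    walk-++ wnil w = w
    walk-++ (wcons v) w = wcons (walk-++ v w)

    walk-split : ∀ A {B k r} → Walk f k (A ++ B) r → ∃ λ m → Walk f k A m × Walk f m B r
    walk-split [] w = _ , wnil , w
    walk-split (a ∷ A) (wcons w) with walk-split A w
    ... | m , w1 , w2 = m , wcons w1 , w2

    walk-snoc : ∀ {k A m} → Walk f k A m → Walk f k (A ++ [ m ]) (f m)
    walk-snoc w = walk-++ w (wcons wnil)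

    walk-single : ∀ {k y m} → Walk f k [ y ] m → k ≡ y × f y ≡ m
    walk-single (wcons wnil) = refl , refl

    walk-start : ∀ {k y L m} → Walk f k (y ∷ L) m → k ≡ y
    walk-start (wcons _) = refl

    walk-nil : ∀ {k m} → Walk f k [] m → k ≡ m
    walk-nil wnil = refl

    walk-transfer : ∀ {g : ℕ → ℕ} {k L m} → Walk f k L m → (∀ {x} → x ∈ L → g x ≡ f x) → Walk g k L m
    walk-transfer wnil h = wnil
    walk-transfer {g} {k} (wcons {L = L} {m = m} w) h = wcons (subst (λ z → Walk g z L m) (sym (h (here refl))) (walk-transfer w (λ m → h (there m))))

    walk-tail : ∀ {k L m} → Walk f k (k ∷ L) m → Walk f (f k) L m
    walk-tail (wcons w) = w

  orbitFrom-walk : ∀ π fuel {j k L} → Walk (app π) k L j → j ∉ L → length L ≤ fuel → orbitFrom fuel π j k ≡ L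
  orbitFrom-walk π zero wnil _ _ = refl
  orbitFrom-walk π (suc fuel) {j} wnil _ _ rewrite ≡ᵇ-refl j = refl
  orbitFrom-walk π (suc fuel) {j} {k} (wcons w) j∉ (s≤s le)
    rewrite ≢⇒≡ᵇ-false {k} {j} (λ e → j∉ (here (sym e))) = cong (k ∷_) (orbitFrom-walk π fuel w (λ m → j∉ (there m)) le)

  cycleOf-walk : ∀ π {j L} → Walk (app π) (app π j) L j → j ∉ L → length L ≤ length π → cycleOf π j ≡ j ∷ L
  cycleOf-walk π w j∉L le = cong (_ ∷_) (orbitFrom-walk π (length π) w j∉L le)

  module Cycles (n : ℕ) (π : List ℕ) (isPerm : Perm n π) where

    f : ℕ → ℕ
    f = app π

    Dom : ℕ → Set
    Dom x = x ∈ oneTo n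

    Dom-sub : ∀ {L} → All Dom L → ∀ {x} → x ∈ L → x ∈ oneTo n
    Dom-sub a m = All.lookup a m

    len-bound : ∀ {L} → Unique L → All Dom L → length L ≤ n
    len-bound {L} u a = subst (length L ≤_) (LP.length-applyUpTo suc n) (unique⊆⇒length≤ L (oneTo n) u (Dom-sub a))

    private
      -- The predecessors of x on its two visits would have the same image under π.
      walk-revisit-absurd : ∀ {j W' x} → x ∈ j ∷ W' → x ≢ j → Walk f j (j ∷ W') x → Unique (j ∷ W') → All Dom (j ∷ W') → ⊥
      walk-revisit-absurd {j} {W'} {x} m ne w u al with ∈-∃++ m
      ... | A , B , eq with walk-split A (subst (λ z → Walk f j z x) eq w)
      ... | y0 , wA , wB with walk-start wB
      ... | refl with A
      ...   | [] = ne (sym (walk-nil wA))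
      ...   | a0 ∷ A' with snoc-view (a0 ∷ A') (λ ())
      ...     | A0 , y , eqA0 with walk-split A0 (subst (λ z → Walk f j z x) eqA0 wA)
      ...       | t , _ , wy with walk-single wy
      ...         | _ , fy with snoc-view (x ∷ B) (λ ())
      ...           | C , z , eqC with walk-split C (subst (λ zz → Walk f x zz x) eqC wB)
      ...             | t' , _ , wz with walk-single wz
      ...               | _ , fz = uniq-fail
        where
        u' : Unique ((a0 ∷ A') ++ x ∷ B)
        u' = subst Unique eq u
        a' : All Dom ((a0 ∷ A') ++ x ∷ B)
        a' = subst (All Dom) eq al
        y∈ : y ∈ a0 ∷ A'
        y∈ = subst (y ∈_) (sym eqA0) (∈-++⁺ʳ A0 (here refl))
        z∈ : z ∈ x ∷ B
        z∈ = subst (z ∈_) (sym eqC) (∈-++⁺ʳ C (here refl))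
        uniq-fail : ⊥
        uniq-fail = unique-++⇒≢ (a0 ∷ A') u' y∈ z∈
          (app-injective n isPerm (All.lookup a' (∈-++⁺ˡ y∈)) (All.lookup a' (∈-++⁺ʳ (a0 ∷ A') z∈)) (trans fy (sym fz)))

      extend-walk : ∀ fuel j W' x → suc n ≤ length (j ∷ W') ℕ.+ fuel → Walk f j (j ∷ W') x → Unique (j ∷ W') → All Dom (j ∷ W') → Dom x →
             ∃ λ L → Walk f (f j) L j × Unique (j ∷ L) × All Dom (j ∷ L)
      extend-walk fuel j W' x inv w u a rx with x ℕ.≟ j
      ... | yes refl = W' , walk-tail w , u , a
      ... | no ne with x ∈? (j ∷ W')
      ...   | yes m = ⊥-elim (walk-revisit-absurd m ne w u a)
      ...   | no x∉ with fuel
      ...     | zero = ⊥-elim (NP.<⇒≱ (subst (suc n ≤_) (NP.+-identityʳ _) inv) (len-bound u a))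
      ...     | suc fuel' = extend-walk fuel' j (W' ++ [ x ]) (f x)
                (subst (suc n ≤_) (trans (NP.+-suc (suc (length W')) fuel') (cong (λ z → suc z ℕ.+ fuel') (trans (NP.+-comm 1 (length W')) (sym (LP.length-++ W'))))) inv)
                (walk-snoc w)
                (UP.++⁺ u ([] ∷ []) (λ { (v∈ , here refl) → x∉ v∈ }))
                (AllP.++⁺ a (rx ∷ []))
                (app-∈oneTo n isPerm rx)

    orbit-walk : ∀ j → Dom j → ∃ λ L → Walk f (f j) L j × Unique (j ∷ L) × All Dom (j ∷ L)
    orbit-walk j rj = extend-walk n j [] (f j) NP.≤-refl (wcons wnil) ([] ∷ []) (rj ∷ []) (app-∈oneTo n isPerm rj)

    cycleOf-closedWalk : ∀ {m K} → Walk f m (m ∷ K) m → Unique (m ∷ K) → All Dom (m ∷ K) → cycleOf π m ≡ m ∷ K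
    cycleOf-closedWalk {m} {K} w (am ∷ u) a = cong (m ∷_) (orbitFrom-walk π (length π) (walk-tail w) (λ mm → All.lookup am mm refl)
      (subst (length K ≤_) (sym (perm-length n isPerm)) (NP.≤-trans (NP.n≤1+n _) (len-bound (am ∷ u) a))))

    cycleOf-orbit : ∀ j → Dom j → ∃ λ L → Walk f (f j) L j × Unique (j ∷ L) × All Dom (j ∷ L) × cycleOf π j ≡ j ∷ L
    cycleOf-orbit j rj with orbit-walk j rj
    ... | L , w , u , a = L , w , u , a , cycleOf-closedWalk (wcons w) u a

    cycle-unique : ∀ j → Dom j → Unique (cycleOf π j)
    cycle-unique j rj with cycleOf-orbit j rj
    ... | L , w , u , a , e = subst Unique (sym e) u

    cycle-range : ∀ j → Dom j → All Dom (cycleOf π j)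
    cycle-range j rj with cycleOf-orbit j rj
    ... | L , w , u , a , e = subst (All Dom) (sym e) a

    cycleOf-rotate : ∀ j → Dom j → ∀ {m} → m ∈ cycleOf π j → cycleOf π m ↭ cycleOf π j
    cycleOf-rotate j rj {m} mm with cycleOf-orbit j rj
    ... | L , w , u , a , e with ∈-∃++ (subst (m ∈_) e mm)
    ... | A , B , eq = subst (λ z → cycleOf π m ↭ z) (sym (trans e eq))
        (subst (λ z → z ↭ A ++ m ∷ B) (sym ceq) rot)
      where
      wj : Walk f j (A ++ m ∷ B) j
      wj = subst (λ z → Walk f j z j) eq (wcons w)
      rot : m ∷ B ++ A ↭ A ++ m ∷ B
      rot = ↭-sym (↭-trans (shift m A B) (prep m (++-comm A B)))
      ws = walk-split A wj
      wm : Walk f m (m ∷ B ++ A) m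
      wm with ws
      ... | y , wA , wB with walk-start wB
      ... | refl = walk-++ wB wA
      ceq : cycleOf π m ≡ m ∷ B ++ A
      ceq = cycleOf-closedWalk wm (Unique-resp-↭ (↭-sym rot) (subst Unique eq u)) (All-resp-↭ (↭-sym rot) (subst (All Dom) eq a))

  filterᵇ-∈⁻ : ∀ (p : ℕ → Bool) xs {x} → x ∈ filterᵇ p xs → x ∈ xs × p x ≡ true
  filterᵇ-∈⁻ p (y ∷ xs) m with p y in eq
  filterᵇ-∈⁻ p (y ∷ xs) (here refl) | true = here refl , eq
  filterᵇ-∈⁻ p (y ∷ xs) (there m) | true = map₁ there (filterᵇ-∈⁻ p xs m)
  filterᵇ-∈⁻ p (y ∷ xs) m | false = map₁ there (filterᵇ-∈⁻ p xs m)

  filterᵇ-∈⁺ : ∀ (p : ℕ → Bool) xs {x} → x ∈ xs → p x ≡ true → x ∈ filterᵇ p xs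
  filterᵇ-∈⁺ p (y ∷ xs) m px with p y in eq
  filterᵇ-∈⁺ p (y ∷ xs) (here refl) px | true = here refl
  filterᵇ-∈⁺ p (y ∷ xs) (there m) px | true = there (filterᵇ-∈⁺ p xs m px)
  filterᵇ-∈⁺ p (y ∷ xs) (here refl) px | false with () ← trans (sym eq) px
  filterᵇ-∈⁺ p (y ∷ xs) (there m) px | false = filterᵇ-∈⁺ p xs m px

  filterᵇ-unique : ∀ (p : ℕ → Bool) xs → Unique xs → Unique (filterᵇ p xs)
  filterᵇ-unique p xs = UP.filter⁺ (T? ∘ p)

  allᵇ-sound : ∀ (p : ℕ → Bool) xs → allᵇ p xs ≡ true → ∀ {y} → y ∈ xs → p y ≡ true
  allᵇ-sound p (x ∷ xs) e m with p x in eq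
  allᵇ-sound p (x ∷ xs) e (here refl) | true = eq
  allᵇ-sound p (x ∷ xs) e (there m) | true = allᵇ-sound p xs e m

  allᵇ-complete : ∀ (p : ℕ → Bool) xs → (∀ {y} → y ∈ xs → p y ≡ true) → allᵇ p xs ≡ true
  allᵇ-complete p [] h = refl
  allᵇ-complete p (x ∷ xs) h rewrite h (here refl) = allᵇ-complete p xs (λ m → h (there m))

  minimum : ℕ → List ℕ → ℕ
  minimum a [] = a
  minimum a (y ∷ ys) = minimum (a ⊓ y) ys

  minimum-∈ : ∀ a ys → minimum a ys ∈ a ∷ ys
  minimum-∈ a [] = here refl
  minimum-∈ a (y ∷ ys) with minimum-∈ (a ⊓ y) ys | NP.⊓-sel a y
  ... | here e | inj₁ e' = here (trans e e')
  ... | here e | inj₂ e' = there (here (trans e e'))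
  ... | there m | _ = there (there m)

  minimum-≤ : ∀ a ys {z} → z ∈ a ∷ ys → minimum a ys ≤ z
  minimum-≤ a [] (here refl) = NP.≤-refl
  minimum-≤ a (y ∷ ys) (here refl) = NP.≤-trans (minimum-≤ (a ⊓ y) ys (here refl)) (NP.m⊓n≤m a y)
  minimum-≤ a (y ∷ ys) (there (here refl)) = NP.≤-trans (minimum-≤ (a ⊓ y) ys (here refl)) (NP.m⊓n≤n a y)
  minimum-≤ a (y ∷ ys) (there (there m)) = minimum-≤ (a ⊓ y) ys (there m)

  module Decomposition (n : ℕ) (π : List ℕ) (isPerm : Perm n π) where
    open Cycles n π isPerm

    minima : List ℕ
    minima = filterᵇ (isCycleMin π) (oneTo (length π))

    minima≡ : minima ≡ filterᵇ (isCycleMin π) (oneTo n)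
    minima≡ = cong (λ k → filterᵇ (isCycleMin π) (oneTo k)) (perm-length n isPerm)

    minima-∈⁻ : ∀ {m} → m ∈ minima → Dom m × isCycleMin π m ≡ true
    minima-∈⁻ mm = filterᵇ-∈⁻ (isCycleMin π) (oneTo n) (subst (_ ∈_) minima≡ mm)

    minima-∈⁺ : ∀ {m} → Dom m → isCycleMin π m ≡ true → m ∈ minima
    minima-∈⁺ r e = subst (_ ∈_) (sym minima≡) (filterᵇ-∈⁺ (isCycleMin π) (oneTo n) r e)

    minima-unique : Unique minima
    minima-unique = subst Unique (sym minima≡) (filterᵇ-unique (isCycleMin π) (oneTo n) (oneTo-unique n))

    isCycleMin-≤ : ∀ {m y} → isCycleMin π m ≡ true → y ∈ cycleOf π m → m ≤ y
    isCycleMin-≤ {m} e ym = ≤ᵇ-true⇒≤ (allᵇ-sound (m ≤ᵇ_) (cycleOf π m) e ym)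

    cycles-disjoint : ∀ {m₁ m₂} → m₁ ∈ minima → m₂ ∈ minima → m₁ ≢ m₂ → Disjoint (cycleOf π m₁) (cycleOf π m₂)
    cycles-disjoint {m₁} {m₂} h₁ h₂ ne (x₁ , x₂) with minima-∈⁻ h₁ | minima-∈⁻ h₂
    ... | r₁ , c₁ | r₂ , c₂ = ne (NP.≤-antisym le₁ le₂)
      where
      p₁ = cycleOf-rotate m₁ r₁ x₁
      p₂ = cycleOf-rotate m₂ r₂ x₂
      le₁ : m₁ ≤ m₂
      le₁ = isCycleMin-≤ c₁ (∈-resp-↭ p₁ (∈-resp-↭ (↭-sym p₂) (here refl)))
      le₂ : m₂ ≤ m₁
      le₂ = isCycleMin-≤ c₂ (∈-resp-↭ p₂ (∈-resp-↭ (↭-sym p₁) (here refl)))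

    concat-cycles-unique : Unique (concat (cycles π))
    concat-cycles-unique = UP.concat⁺ (all-unique minima (λ m → m)) (APP.map⁺ (pairwise-disjoint minima minima-unique (λ m → m)))
      where
      all-unique : ∀ K → (∀ {m} → m ∈ K → m ∈ minima) → All Unique (map (cycleOf π) K)
      all-unique [] _ = []
      all-unique (k ∷ K) h = cycle-unique k (proj₁ (minima-∈⁻ (h (here refl)))) ∷ all-unique K (λ m → h (there m))
      pairwise-disjoint : ∀ K → Unique K → (∀ {m} → m ∈ K → m ∈ minima) → AllPairs (λ a b → Disjoint (cycleOf π a) (cycleOf π b)) K
      pairwise-disjoint [] _ _ = []
      pairwise-disjoint (k ∷ K) (r ∷ u) h = disjoint-from K r (λ m → h (there m)) ∷ pairwise-disjoint K u (λ m → h (there m))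
        where
        disjoint-from : ∀ K' → All (k ≢_) K' → (∀ {m} → m ∈ K' → m ∈ minima) → All (λ b → Disjoint (cycleOf π k) (cycleOf π b)) K'
        disjoint-from [] _ _ = []
        disjoint-from (t ∷ K') (ne ∷ ns) h' = cycles-disjoint (h (here refl)) (h' (here refl)) ne ∷ disjoint-from K' ns (λ m → h' (there m))

    ∈-cycles⁻ : ∀ {C} → C ∈ cycles π → ∃ λ m → m ∈ minima × C ≡ cycleOf π m
    ∈-cycles⁻ = ∈-map⁻ (cycleOf π)

    covering-cycle : ∀ {z} → Dom z → ∃ λ m → m ∈ minima × z ∈ cycleOf π m
    covering-cycle {z} rz = m , minima-∈⁺ rm icm , ∈-resp-↭ (↭-sym rot) (here refl)
      where
      m = minimum z (proj₁ (cycleOf-orbit z rz))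
      ceq = proj₂ (proj₂ (proj₂ (proj₂ (cycleOf-orbit z rz))))
      m∈ : m ∈ cycleOf π z
      m∈ = subst (m ∈_) (sym ceq) (minimum-∈ z _)
      rm : Dom m
      rm = All.lookup (cycle-range z rz) m∈
      rot = cycleOf-rotate z rz m∈
      icm : isCycleMin π m ≡ true
      icm = allᵇ-complete (m ≤ᵇ_) (cycleOf π m) (λ {y} ym → ≤⇒≤ᵇ-true (minimum-≤ z _ (subst (y ∈_) ceq (∈-resp-↭ rot ym))))

    partition : concat (cycles π) ↭ oneTo n
    partition = sameElements⇒↭ concat-cycles-unique (oneTo-unique n) fwd bwd
      where
      fwd : ∀ {z} → z ∈ concat (cycles π) → z ∈ oneTo n
      fwd {z} mz with ∈-concat⁻′ (cycles π) mz
      ... | C , zC , CC with ∈-cycles⁻ CC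
      ... | m , mm , refl = All.lookup (cycle-range m (proj₁ (minima-∈⁻ mm))) zC
      bwd : ∀ {z} → z ∈ oneTo n → z ∈ concat (cycles π)
      bwd rz with covering-cycle rz
      ... | m , mm , zm = ∈-concat⁺′ zm (∈-map⁺ (cycleOf π) mm)

  pk : List ℕ → ℕ
  pk = peaksCycle

  insertAfter : ℕ → ℕ → List ℕ → List ℕ
  insertAfter i x [] = []
  insertAfter i x (y ∷ ys) = if y ≡ᵇ i then y ∷ x ∷ ys else y ∷ insertAfter i x ys

  insertAfterEach : ℕ → List ℕ → List (List ℕ)
  insertAfterEach x [] = []
  insertAfterEach x (a ∷ C) = (a ∷ x ∷ C) ∷ map (a ∷_) (insertAfterEach x C)

  peakAt : ℕ → ℕ → List ℕ → ℕ
  peakAt a b [] = 0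
  peakAt a b (c ∷ _) = if (a <ᵇ b) ∧ (c <ᵇ b) then 1 else 0

  pk-∷-∷ : ∀ a b C → pk (a ∷ b ∷ C) ≡ peakAt a b C + pk (b ∷ C)
  pk-∷-∷ a b [] = refl
  pk-∷-∷ a b (c ∷ C) = refl

  peakAt-0∨1 : ∀ a b C → peakAt a b C ≡ 0 ⊎ peakAt a b C ≡ 1
  peakAt-0∨1 a b [] = inj₁ refl
  peakAt-0∨1 a b (c ∷ C) with (a <ᵇ b) ∧ (c <ᵇ b)
  ... | true = inj₂ refl
  ... | false = inj₁ refl

  peakAt-adjacent : ∀ a b c D → peakAt a b (c ∷ D) ≡ 1 → peakAt b c D ≡ 0
  peakAt-adjacent a b c [] _ = refl
  peakAt-adjacent a b c (d ∷ D) e with a <ᵇ b | c <ᵇ b in eq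
  ... | true | true rewrite ≥⇒<ᵇ-false {b} {c} (NP.<⇒≤ (<ᵇ-true⇒< eq)) = refl
  ... | true | false with () ← e
  ... | false | _ with () ← e

  pk-max-∷ : ∀ x b rest → b < x → pk (x ∷ b ∷ rest) ≡ pk (b ∷ rest)
  pk-max-∷ x b [] lt = refl
  pk-max-∷ x b (c ∷ rest) lt rewrite ≥⇒<ᵇ-false {x} {b} (NP.<⇒≤ lt) = refl

  pk-∷-max-∷ : ∀ a x b rest → a < x → b < x → pk (a ∷ x ∷ b ∷ rest) ≡ suc (pk (b ∷ rest))
  pk-∷-max-∷ a x b rest ax bx rewrite <⇒<ᵇ-true ax | <⇒<ᵇ-true bx = cong suc (pk-max-∷ x b rest bx)

  pk-∷-∷-max : ∀ a b x rest → b < x → pk (a ∷ b ∷ x ∷ rest) ≡ pk (b ∷ x ∷ rest)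
  pk-∷-∷-max a b x rest bx rewrite ≥⇒<ᵇ-false {x} {b} (NP.<⇒≤ bx) with a <ᵇ b
  ... | true = refl
  ... | false = refl

  insertAfterEach-head : ∀ x c D {Z} → Z ∈ insertAfterEach x (c ∷ D) → ∃ λ Z' → Z ≡ c ∷ Z'
  insertAfterEach-head x c D (here refl) = _ , refl
  insertAfterEach-head x c D (there m) with ∈-map⁻ (c ∷_) m
  ... | Y , _ , refl = Y , refl

  length-insertAfterEach : ∀ x C → length (insertAfterEach x C) ≡ length C
  length-insertAfterEach x [] = refl
  length-insertAfterEach x (a ∷ C) = cong suc (trans (LP.length-map (a ∷_) (insertAfterEach x C)) (length-insertAfterEach x C))

  map-cong∈ : {A B : Set} (L : List A) {f g : A → B} → (∀ {a} → a ∈ L → f a ≡ g a) → map f L ≡ map g L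
  map-cong∈ [] h = refl
  map-cong∈ (x ∷ L) h = cong₂ _∷_ (h (here refl)) (map-cong∈ L (λ m → h (there m)))

  sumℕ-const+ : {A : Set} (L : List A) (t : ℕ) (g : A → ℕ) → sumℕ (map (λ Z → t + g Z) L) ≡ length L * t + sumℕ (map g L)
  sumℕ-const+ [] t g = refl
  sumℕ-const+ (z ∷ L) t g rewrite sumℕ-const+ L t g = rearrange t (g z) (length L) (sumℕ (map g L))
    where
    rearrange : ∀ t gz l s → (t + gz) + (l * t + s) ≡ suc l * t + (gz + s)
    rearrange = NS.solve-∀

  sumℕ-map∘ : {A B : Set} (L : List A) (h : A → B) (g : B → ℕ) → sumℕ (map g (map h L)) ≡ sumℕ (map (λ a → g (h a)) L)
  sumℕ-map∘ L h g = cong sumℕ (sym (LP.map-∘ L))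

  peakSum : ℕ → List ℕ → ℕ
  peakSum x C = sumℕ (map pk (insertAfterEach x C))

  peakSum-∷-∷ : ∀ x a b C'' → All (_< x) (a ∷ b ∷ C'') →
    peakSum x (a ∷ b ∷ C'') ≡ suc (pk (b ∷ C'')) + (peakSum x (b ∷ C'') + length C'' * peakAt a b C'')
  peakSum-∷-∷ x a b C'' (ax ∷ bx ∷ _) = begin
    pk (a ∷ x ∷ b ∷ C'') + sumℕ (map pk (map (a ∷_) (insertAfterEach x (b ∷ C''))))
      ≡⟨ cong₂ _+_ (pk-∷-max-∷ a x b C'' ax bx) (sumℕ-map∘ (insertAfterEach x (b ∷ C'')) (a ∷_) pk) ⟩
    suc (pk (b ∷ C'')) + sumℕ (map (λ Y → pk (a ∷ Y)) (insertAfterEach x (b ∷ C'')))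
      ≡⟨ cong (suc (pk (b ∷ C'')) +_) tail-sum ⟩
    suc (pk (b ∷ C'')) + (peakSum x (b ∷ C'') + length C'' * peakAt a b C'') ∎
    where
    tail-sum : sumℕ (map (λ Y → pk (a ∷ Y)) (insertAfterEach x (b ∷ C''))) ≡ peakSum x (b ∷ C'') + length C'' * peakAt a b C''
    tail-sum = begin
      pk (a ∷ b ∷ x ∷ C'') + sumℕ (map (λ Y → pk (a ∷ Y)) (map (b ∷_) (insertAfterEach x C'')))
        ≡⟨ cong₂ _+_ (pk-∷-∷-max a b x C'' bx) (sumℕ-map∘ (insertAfterEach x C'') (b ∷_) (λ Y → pk (a ∷ Y))) ⟩
      pk (b ∷ x ∷ C'') + sumℕ (map (λ Z → pk (a ∷ b ∷ Z)) (insertAfterEach x C''))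
        ≡⟨ cong (λ z → pk (b ∷ x ∷ C'') + sumℕ z) (prefix-peak C'') ⟩
      pk (b ∷ x ∷ C'') + sumℕ (map (λ Z → peakAt a b C'' + pk (b ∷ Z)) (insertAfterEach x C''))
        ≡⟨ cong (pk (b ∷ x ∷ C'') +_) (sumℕ-const+ (insertAfterEach x C'') (peakAt a b C'') (λ Z → pk (b ∷ Z))) ⟩
      pk (b ∷ x ∷ C'') + (length (insertAfterEach x C'') * peakAt a b C'' + sumℕ (map (λ Z → pk (b ∷ Z)) (insertAfterEach x C'')))
        ≡⟨ cong (λ l → pk (b ∷ x ∷ C'') + (l * peakAt a b C'' + sumℕ (map (λ Z → pk (b ∷ Z)) (insertAfterEach x C'')))) (length-insertAfterEach x C'') ⟩
      pk (b ∷ x ∷ C'') + (length C'' * peakAt a b C'' + sumℕ (map (λ Z → pk (b ∷ Z)) (insertAfterEach x C'')))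
        ≡⟨ rearrange (pk (b ∷ x ∷ C'')) (length C'' * peakAt a b C'') _ ⟩
      (pk (b ∷ x ∷ C'') + sumℕ (map (λ Z → pk (b ∷ Z)) (insertAfterEach x C''))) + length C'' * peakAt a b C''
        ≡⟨ cong (_+ length C'' * peakAt a b C'') (cong (pk (b ∷ x ∷ C'') +_) (sym (sumℕ-map∘ (insertAfterEach x C'') (b ∷_) pk))) ⟩
      peakSum x (b ∷ C'') + length C'' * peakAt a b C'' ∎
      where
      rearrange : ∀ p q r → p + (q + r) ≡ (p + r) + q
      rearrange = NS.solve-∀
      prefix-peak : ∀ D → map (λ Z → pk (a ∷ b ∷ Z)) (insertAfterEach x D) ≡ map (λ Z → peakAt a b D + pk (b ∷ Z)) (insertAfterEach x D)
      prefix-peak [] = refl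
      prefix-peak (c ∷ D) = map-cong∈ (insertAfterEach x (c ∷ D)) λ m → peak-of-prefixed (insertAfterEach-head x c D m)
        where
        peak-of-prefixed : ∀ {Z} → (∃ λ Z' → Z ≡ c ∷ Z') → pk (a ∷ b ∷ Z) ≡ peakAt a b (c ∷ D) + pk (b ∷ Z)
        peak-of-prefixed (Z' , refl) = refl

  peakSum-identity : ∀ x C → All (_< x) C → C ≢ [] → peakSum x C + 2 * pk C + 1 ≡ length C * pk C + length C
  peakSum-identity x [] _ ne = ⊥-elim (ne refl)
  peakSum-identity x (a ∷ []) _ _ = refl
  peakSum-identity x (a ∷ b ∷ C'') al@(_ ∷ al') _ = begin
    peakSum x (a ∷ b ∷ C'') + 2 * pk (a ∷ b ∷ C'') + 1
      ≡⟨ cong₂ (λ u v → u + 2 * v + 1) (peakSum-∷-∷ x a b C'' al) (pk-∷-∷ a b C'') ⟩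
    suc p' + (F' + m * t) + 2 * (t + p') + 1 ≡⟨ rearrange₁ p' F' m t ⟩
    (F' + 2 * p' + 1) + (p' + 1 + m * t + 2 * t) ≡⟨ cong (_+ (p' + 1 + m * t + 2 * t)) (peakSum-identity x (b ∷ C'') al' (λ ())) ⟩
    (suc m * p' + suc m) + (p' + 1 + m * t + 2 * t) ≡⟨ rearrange₂ p' m t ⟩
    suc (suc m) * (t + p') + suc (suc m)
      ≡⟨ cong (λ v → suc (suc m) * v + suc (suc m)) (sym (pk-∷-∷ a b C'')) ⟩
    length (a ∷ b ∷ C'') * pk (a ∷ b ∷ C'') + length (a ∷ b ∷ C'') ∎
    where
    p' = pk (b ∷ C'')
    F' = peakSum x (b ∷ C'')
    m = length C''
    t = peakAt a b C''
    rearrange₁ : ∀ p' F' m t → suc p' + (F' + m * t) + 2 * (t + p') + 1 ≡ (F' + 2 * p' + 1) + (p' + 1 + m * t + 2 * t)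
    rearrange₁ = NS.solve-∀
    rearrange₂ : ∀ p' m t → (suc m * p' + suc m) + (p' + 1 + m * t + 2 * t) ≡ suc (suc m) * (t + p') + suc (suc m)
    rearrange₂ = NS.solve-∀

  SameOrSuc : ℕ → ℕ → Set
  SameOrSuc v p = v ≡ p ⊎ v ≡ suc p

  sameOrSuc-∷-∷ : ∀ x a b C'' → All (_< x) (a ∷ b ∷ C'') →
    (∀ {X} → X ∈ insertAfterEach x (b ∷ C'') → SameOrSuc (pk X) (pk (b ∷ C''))) →
    ∀ {X} → X ∈ insertAfterEach x (a ∷ b ∷ C'') → SameOrSuc (pk X) (pk (a ∷ b ∷ C''))
  sameOrSuc-∷-∷ x a b C'' (ax ∷ bx ∷ al) ih (here refl) rewrite pk-∷-max-∷ a x b C'' ax bx | pk-∷-∷ a b C'' with peakAt-0∨1 a b C''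
  ... | inj₁ e rewrite e = inj₂ refl
  ... | inj₂ e rewrite e = inj₁ refl
  sameOrSuc-∷-∷ x a b C'' (ax ∷ bx ∷ al) ih (there m) with ∈-map⁻ (a ∷_) m
  ... | Y , here refl , refl rewrite pk-∷-∷-max a b x C'' bx = after-second C'' al
    where
    after-second : ∀ C'' → All (_< x) C'' → SameOrSuc (pk (b ∷ x ∷ C'')) (pk (a ∷ b ∷ C''))
    after-second [] _ = inj₁ refl
    after-second (c ∷ D) (cx ∷ _) rewrite pk-∷-max-∷ b x c D bx cx | pk-∷-∷ a b (c ∷ D) | pk-∷-∷ b c D with peakAt-0∨1 a b (c ∷ D)
    ... | inj₂ e rewrite e | peakAt-adjacent a b c D e = inj₁ refl
    ... | inj₁ e rewrite e with peakAt-0∨1 b c D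
    ...   | inj₁ e' rewrite e' = inj₂ refl
    ...   | inj₂ e' rewrite e' = inj₁ refl
  ... | Y , there m' , refl with ∈-map⁻ (b ∷_) m'
  ... | Z , Zm , refl = after-later (allIns-head' C'' Zm)
    where
    allIns-head' : ∀ C'' → Z ∈ insertAfterEach x C'' → ∃ λ c → ∃ λ D → ∃ λ Z' → C'' ≡ c ∷ D × Z ≡ c ∷ Z'
    allIns-head' [] ()
    allIns-head' (c ∷ D) mm with insertAfterEach-head x c D mm
    ... | Z' , e = c , D , Z' , refl , e
    ih-tail : SameOrSuc (pk (b ∷ Z)) (pk (b ∷ C''))
    ih-tail = ih (there (∈-map⁺ (b ∷_) Zm))
    after-later : (∃ λ c → ∃ λ D → ∃ λ Z' → C'' ≡ c ∷ D × Z ≡ c ∷ Z') → SameOrSuc (pk (a ∷ b ∷ Z)) (pk (a ∷ b ∷ C''))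
    after-later (c , D , Z' , refl , refl) with ih-tail
    ... | inj₁ e = inj₁ (cong (peakAt a b (c ∷ D) +_) e)
    ... | inj₂ e = inj₂ (trans (cong (peakAt a b (c ∷ D) +_) e) (NP.+-suc _ _))

  insertAfterEach-peaks : ∀ x C → All (_< x) C → ∀ {X} → X ∈ insertAfterEach x C → SameOrSuc (pk X) (pk C)
  insertAfterEach-peaks x (a ∷ []) _ (here refl) = inj₁ refl
  insertAfterEach-peaks x (a ∷ []) _ (there ())
  insertAfterEach-peaks x (a ∷ b ∷ C'') al@(_ ∷ al') m = sameOrSuc-∷-∷ x a b C'' al (insertAfterEach-peaks x (b ∷ C'') al') m

  countᵇ-map : {A B : Set} (p : B → Bool) (h : A → B) (L : List A) → countᵇ p (map h L) ≡ countᵇ (λ a → p (h a)) L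
  countᵇ-map p h [] = refl
  countᵇ-map p h (a ∷ L) with p (h a)
  ... | true = cong suc (countᵇ-map p h L)
  ... | false = countᵇ-map p h L

  sum-SameOrSuc : ∀ (vs : List ℕ) p → (∀ {v} → v ∈ vs → SameOrSuc v p) → sumℕ vs ≡ length vs * p + countᵇ (λ v → v ≡ᵇ suc p) vs
  sum-SameOrSuc [] p h = refl
  sum-SameOrSuc (v ∷ vs) p h with h (here refl)
  ... | inj₁ refl rewrite ≢⇒≡ᵇ-false {p} {suc p} (λ e → NP.<-irrefl e (NP.n<1+n p)) | sum-SameOrSuc vs p (λ m → h (there m)) = sym (NP.+-assoc p _ _)
  ... | inj₂ refl rewrite ≡ᵇ-refl p | sum-SameOrSuc vs p (λ m → h (there m)) = rearrange p (length vs) (countᵇ (λ v → v ≡ᵇ suc p) vs)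
    where
    rearrange : ∀ p l c → suc p + (l * p + c) ≡ p + l * p + suc c
    rearrange = NS.solve-∀

  insertAfter-map : ∀ x C → Unique C → map (λ i → insertAfter i x C) C ≡ insertAfterEach x C
  insertAfter-map x [] _ = refl
  insertAfter-map x (a ∷ C) (aa ∷ u) rewrite ≡ᵇ-refl a = cong ((a ∷ x ∷ C) ∷_) (trans
    (map-cong∈ C (λ {i} m → insertAfter-∷ i m)) (trans (LP.map-∘ C) (cong (map (a ∷_)) (insertAfter-map x C u))))
    where
    insertAfter-∷ : ∀ i → i ∈ C → insertAfter i x (a ∷ C) ≡ a ∷ insertAfter i x C
    insertAfter-∷ i m rewrite ≢⇒≡ᵇ-false {a} {i} (All.lookup aa m) = refl

  insertAfter-peaks : ∀ x C → Unique C → All (_< x) C → ∀ {i} → i ∈ C → SameOrSuc (pk (insertAfter i x C)) (pk C)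
  insertAfter-peaks x C u al {i} m = insertAfterEach-peaks x C al (subst (insertAfter i x C ∈_) (insertAfter-map x C u) (∈-map⁺ (λ i → insertAfter i x C) m))

  raising-positions : ∀ x C → Unique C → All (_< x) C → C ≢ [] →
    countᵇ (λ i → pk (insertAfter i x C) ≡ᵇ suc (pk C)) C + 2 * pk C + 1 ≡ length C
  raising-positions x C u al ne = NP.+-cancelˡ-≡ (length C * pk C) _ _ (begin
    l * p + (c + 2 * p + 1) ≡⟨ rearrange l p c ⟩
    (l * p + c) + 2 * p + 1 ≡⟨ cong (λ z → z + 2 * p + 1) (sym sum-eq) ⟩
    peakSum x C + 2 * p + 1 ≡⟨ peakSum-identity x C al ne ⟩
    l * p + l ∎)
    where
    l = length C
    p = pk C
    c = countᵇ (λ i → pk (insertAfter i x C) ≡ᵇ suc (pk C)) C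
    rearrange : ∀ l p c → l * p + (c + 2 * p + 1) ≡ (l * p + c) + 2 * p + 1
    rearrange = NS.solve-∀
    L = insertAfterEach x C
    cnt-eq : c ≡ countᵇ (λ v → v ≡ᵇ suc p) (map pk L)
    cnt-eq = begin
      c ≡⟨ sym (countᵇ-map (λ X → pk X ≡ᵇ suc p) (λ i → insertAfter i x C) C) ⟩
      countᵇ (λ X → pk X ≡ᵇ suc p) (map (λ i → insertAfter i x C) C) ≡⟨ cong (countᵇ (λ X → pk X ≡ᵇ suc p)) (insertAfter-map x C u) ⟩
      countᵇ (λ X → pk X ≡ᵇ suc p) L ≡⟨ sym (countᵇ-map (λ v → v ≡ᵇ suc p) pk L) ⟩
      countᵇ (λ v → v ≡ᵇ suc p) (map pk L) ∎
    sum-eq : peakSum x C ≡ l * p + c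
    sum-eq = begin
      sumℕ (map pk L) ≡⟨ sum-SameOrSuc (map pk L) p (λ m → sameOrSuc-pk m) ⟩
      length (map pk L) * p + countᵇ (λ v → v ≡ᵇ suc p) (map pk L)
        ≡⟨ cong₂ (λ a b → a * p + b) (trans (LP.length-map pk L) (length-insertAfterEach x C)) (sym cnt-eq) ⟩
      l * p + c ∎
      where
      sameOrSuc-pk : ∀ {v} → v ∈ map pk L → SameOrSuc v p
      sameOrSuc-pk m with ∈-map⁻ pk m
      ... | X , Xm , refl = insertAfterEach-peaks x C al Xm

  b2n : Bool → ℕ
  b2n true = 1
  b2n false = 0

  module _ {A : Set} where
    filterᵇ-++ : (p : A → Bool) (xs ys : List A) → filterᵇ p (xs ++ ys) ≡ filterᵇ p xs ++ filterᵇ p ys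
    filterᵇ-++ p = LP.filter-++ (T? ∘ p)

    filterᵇ-cong∈ : (xs : List A) {p q : A → Bool} → (∀ {x} → x ∈ xs → p x ≡ q x) → filterᵇ p xs ≡ filterᵇ q xs
    filterᵇ-cong∈ [] h = refl
    filterᵇ-cong∈ (x ∷ xs) {p} {q} h with p x | q x | h (here refl)
    ... | true | true | _ = cong (x ∷_) (filterᵇ-cong∈ xs (λ m → h (there m)))
    ... | false | false | _ = filterᵇ-cong∈ xs (λ m → h (there m))

    countᵇ-++ : (p : A → Bool) (xs ys : List A) → countᵇ p (xs ++ ys) ≡ countᵇ p xs + countᵇ p ys
    countᵇ-++ p xs ys = trans (cong length (filterᵇ-++ p xs ys)) (LP.length-++ (filterᵇ p xs))

    countᵇ-cong∈ : (xs : List A) {p q : A → Bool} → (∀ {x} → x ∈ xs → p x ≡ q x) → countᵇ p xs ≡ countᵇ q xs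
    countᵇ-cong∈ xs h = cong length (filterᵇ-cong∈ xs h)

    countᵇ-∷ : (p : A → Bool) (x : A) (xs : List A) → countᵇ p (x ∷ xs) ≡ b2n (p x) + countᵇ p xs
    countᵇ-∷ p x xs with p x
    ... | true = refl
    ... | false = refl

    countᵇ-↭ : (p : A → Bool) {xs ys : List A} → xs ↭ ys → countᵇ p xs ≡ countᵇ p ys
    countᵇ-↭ p r = ↭-length (filter-↭ (T? ∘ p) r)

    countᵇ-concat : (p : A → Bool) (xss : List (List A)) → countᵇ p (concat xss) ≡ sumℕ (map (countᵇ p) xss)
    countᵇ-concat p [] = refl
    countᵇ-concat p (xs ∷ xss) = trans (countᵇ-++ p xs (concat xss)) (cong (countᵇ p xs +_) (countᵇ-concat p xss))

    countᵇ-≤ : (p : A → Bool) (xs : List A) → countᵇ p xs ≤ length xs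
    countᵇ-≤ p = LP.length-filter (T? ∘ p)

  length-concat : {A : Set} (xss : List (List A)) → length (concat xss) ≡ sumℕ (map length xss)
  length-concat [] = refl
  length-concat (xs ∷ xss) = trans (LP.length-++ xs) (cong (length xs +_) (length-concat xss))

  sumℕ-cong∈ : {A : Set} (L : List A) {f g : A → ℕ} → (∀ {a} → a ∈ L → f a ≡ g a) → sumℕ (map f L) ≡ sumℕ (map g L)
  sumℕ-cong∈ [] h = refl
  sumℕ-cong∈ (a ∷ L) h = cong₂ _+_ (h (here refl)) (sumℕ-cong∈ L (λ m → h (there m)))

  app-++ˡ : ∀ xs ys k → k < length xs → app (xs ++ ys) (suc k) ≡ app xs (suc k)
  app-++ˡ (x ∷ xs) ys zero _ = refl
  app-++ˡ (x ∷ xs) ys (suc k) (s≤s lt) = app-++ˡ xs ys k lt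

  app-++ʳ : ∀ xs ys r → app (xs ++ ys) (suc (length xs + r)) ≡ app ys (suc r)
  app-++ʳ [] ys r = refl
  app-++ʳ (x ∷ xs) ys r = app-++ʳ xs ys r

  length-setAt : ∀ p v xs → length (setAt p v xs) ≡ length xs
  length-setAt p v [] = refl
  length-setAt zero v (x ∷ xs) = refl
  length-setAt (suc p) v (x ∷ xs) = cong suc (length-setAt p v xs)

  app-setAt-≢ : ∀ p v xs k → k ≢ p → app (setAt p v xs) (suc k) ≡ app xs (suc k)
  app-setAt-≢ p v [] k ne = refl
  app-setAt-≢ zero v (x ∷ xs) zero ne = ⊥-elim (ne refl)
  app-setAt-≢ zero v (x ∷ xs) (suc k) ne = refl
  app-setAt-≢ (suc p) v (x ∷ xs) zero ne = refl
  app-setAt-≢ (suc p) v (x ∷ xs) (suc k) ne = app-setAt-≢ p v xs k (λ e → ne (cong suc e))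

  app-setAt-≡ : ∀ p v xs → p < length xs → app (setAt p v xs) (suc p) ≡ v
  app-setAt-≡ zero v (x ∷ xs) _ = refl
  app-setAt-≡ (suc p) v (x ∷ xs) (s≤s lt) = app-setAt-≡ p v xs lt

  insertAfter-∉ : ∀ i x C → i ∉ C → insertAfter i x C ≡ C
  insertAfter-∉ i x [] _ = refl
  insertAfter-∉ i x (y ∷ C) i∉ rewrite ≢⇒≡ᵇ-false {y} {i} (λ e → i∉ (here (sym e))) = cong (y ∷_) (insertAfter-∉ i x C (λ m → i∉ (there m)))

  insertAfter-split : ∀ i x A B → i ∉ A → insertAfter i x (A ++ i ∷ B) ≡ A ++ i ∷ x ∷ B
  insertAfter-split i x [] B _ rewrite ≡ᵇ-refl i = refl
  insertAfter-split i x (a ∷ A) B i∉ rewrite ≢⇒≡ᵇ-false {a} {i} (λ e → i∉ (here (sym e))) = cong (a ∷_) (insertAfter-split i x A B (λ m → i∉ (there m)))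

  allᵇ-insertAfter : ∀ (q : ℕ → Bool) i x C → q x ≡ true → allᵇ q (insertAfter i x C) ≡ allᵇ q C
  allᵇ-insertAfter q i x [] _ = refl
  allᵇ-insertAfter q i x (y ∷ C) qx with y ≡ᵇ i
  ... | true rewrite qx = refl
  ... | false = cong (q y ∧_) (allᵇ-insertAfter q i x C qx)

  countᵇ-update : (p q : ℕ → Bool) (xs : List ℕ) {i : ℕ} → Unique xs → i ∈ xs →
                  (∀ {x} → x ∈ xs → x ≢ i → p x ≡ q x) →
                  countᵇ p xs + b2n (q i) ≡ countᵇ q xs + b2n (p i)
  countᵇ-update p q (x ∷ xs) (x∉ ∷ _) (here refl) agree = begin
    countᵇ p (x ∷ xs) + b2n (q x)         ≡⟨ cong (_+ b2n (q x)) (countᵇ-∷ p x xs) ⟩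
    b2n (p x) + countᵇ p xs + b2n (q x)   ≡⟨ cong (λ c → b2n (p x) + c + b2n (q x)) rest ⟩
    b2n (p x) + countᵇ q xs + b2n (q x)   ≡⟨ rearrange (b2n (p x)) (countᵇ q xs) (b2n (q x)) ⟩
    b2n (q x) + countᵇ q xs + b2n (p x)   ≡⟨ cong (_+ b2n (p x)) (sym (countᵇ-∷ q x xs)) ⟩
    countᵇ q (x ∷ xs) + b2n (p x)         ∎
    where
    rest : countᵇ p xs ≡ countᵇ q xs
    rest = countᵇ-cong∈ xs (λ m → agree (there m) (λ e → All.lookup x∉ m (sym e)))
    rearrange : ∀ a c b → a + c + b ≡ b + c + a
    rearrange = NS.solve-∀
  countᵇ-update p q (x ∷ xs) {i} (x∉ ∷ u) (there i∈) agree = begin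
    countᵇ p (x ∷ xs) + b2n (q i)           ≡⟨ cong (_+ b2n (q i)) (countᵇ-∷ p x xs) ⟩
    b2n (p x) + countᵇ p xs + b2n (q i)     ≡⟨ NP.+-assoc (b2n (p x)) _ _ ⟩
    b2n (p x) + (countᵇ p xs + b2n (q i))   ≡⟨ cong₂ (λ a c → b2n a + c) (agree (here refl) (All.lookup x∉ i∈))
                                                 (countᵇ-update p q xs u i∈ (λ m → agree (there m))) ⟩
    b2n (q x) + (countᵇ q xs + b2n (p i))   ≡⟨ sym (NP.+-assoc (b2n (q x)) _ _) ⟩
    b2n (q x) + countᵇ q xs + b2n (p i)     ≡⟨ cong (_+ b2n (p i)) (sym (countᵇ-∷ q x xs)) ⟩
    countᵇ q (x ∷ xs) + b2n (p i)           ∎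

  sum-insertAfter : ∀ (x i : ℕ) Cs → Unique (concat Cs) → ∀ {C} → C ∈ Cs → i ∈ C →
    sumℕ (map (pk ∘ insertAfter i x) Cs) + pk C ≡ sumℕ (map pk Cs) + pk (insertAfter i x C)
  sum-insertAfter x i (C₀ ∷ Cs) u (here refl) i∈C₀ = begin
    pk (insertAfter i x C₀) + sumℕ (map (pk ∘ insertAfter i x) Cs) + pk C₀
      ≡⟨ cong (λ s → pk (insertAfter i x C₀) + s + pk C₀) (sumℕ-cong∈ Cs (λ m → cong pk (insertAfter-∉ i x _ (i∉ m)))) ⟩
    pk (insertAfter i x C₀) + sumℕ (map pk Cs) + pk C₀
      ≡⟨ rearrange (pk (insertAfter i x C₀)) (sumℕ (map pk Cs)) (pk C₀) ⟩
    pk C₀ + sumℕ (map pk Cs) + pk (insertAfter i x C₀) ∎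
    where
    rearrange : ∀ a b c → a + b + c ≡ c + b + a
    rearrange = NS.solve-∀
    i∉ : ∀ {C} → C ∈ Cs → i ∉ C
    i∉ m i∈C = unique-++⇒≢ C₀ u i∈C₀ (∈-concat⁺′ i∈C m) refl
  sum-insertAfter x i (C₀ ∷ Cs) u {C} (there m) i∈C = begin
    pk (insertAfter i x C₀) + s′ + pk C ≡⟨ cong (λ D → pk D + s′ + pk C) (insertAfter-∉ i x C₀ i∉C₀) ⟩
    pk C₀ + s′ + pk C                   ≡⟨ NP.+-assoc (pk C₀) s′ (pk C) ⟩
    pk C₀ + (s′ + pk C)                 ≡⟨ cong (pk C₀ +_) (sum-insertAfter x i Cs (unique-++ʳ C₀ u) m i∈C) ⟩
    pk C₀ + (s + pk (insertAfter i x C)) ≡⟨ sym (NP.+-assoc (pk C₀) s _) ⟩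
    pk C₀ + s + pk (insertAfter i x C)  ∎
    where
    s′ = sumℕ (map (pk ∘ insertAfter i x) Cs)
    s = sumℕ (map pk Cs)
    i∉C₀ : i ∉ C₀
    i∉C₀ i∈C₀ = unique-++⇒≢ C₀ u i∈C₀ (∈-concat⁺′ i∈C m) refl

  module Extension (n : ℕ) (π : List ℕ) (isPerm : Perm n π) where
    open Cycles n π isPerm
    open Decomposition n π isPerm

    N : ℕ
    N = suc n

    length-π : length π ≡ n
    length-π = perm-length n isPerm

    Dom⁻ : ∀ {x} → Dom x → ∃ λ k → x ≡ suc k × k < n
    Dom⁻ {x} r with ∈oneTo⁻ r
    ... | s≤s z≤n , le = _ , refl , le

    Dom⇒<N : ∀ {x} → Dom x → x < N
    Dom⇒<N r = s≤s (proj₂ (∈oneTo⁻ r))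

    Dom⇒≢N : ∀ {x} → Dom x → x ≢ N
    Dom⇒≢N r e = NP.<-irrefl e (Dom⇒<N r)

    orbit-length : ∀ {j L} → Unique (j ∷ L) → All Dom (j ∷ L) → length L < N
    orbit-length u a = NP.m≤n⇒m≤1+n (len-bound u a)

    cycles-extension : (σ : List ℕ) (h : List ℕ → List ℕ) → length σ ≡ N →
      (∀ {x} → Dom x → cycleOf σ x ≡ h (cycleOf π x)) →
      (∀ {x} → Dom x → isCycleMin σ x ≡ isCycleMin π x) →
      cycles σ ≡ map h (cycles π) ++ map (cycleOf σ) (filterᵇ (isCycleMin σ) [ N ])
    cycles-extension σ h length-σ cycleOf-σ isCycleMin-σ = begin
      map (cycleOf σ) (filterᵇ (isCycleMin σ) (oneTo (length σ)))
        ≡⟨ cong (map (cycleOf σ) ∘ filterᵇ (isCycleMin σ)) (trans (cong oneTo length-σ) (oneTo-suc n)) ⟩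
      map (cycleOf σ) (filterᵇ (isCycleMin σ) (oneTo n ++ [ N ]))
        ≡⟨ trans (cong (map (cycleOf σ)) (filterᵇ-++ (isCycleMin σ) (oneTo n) [ N ])) (LP.map-++ (cycleOf σ) (filterᵇ (isCycleMin σ) (oneTo n)) (filterᵇ (isCycleMin σ) [ N ])) ⟩
      map (cycleOf σ) (filterᵇ (isCycleMin σ) (oneTo n)) ++ map (cycleOf σ) (filterᵇ (isCycleMin σ) [ N ])
        ≡⟨ cong (_++ _) old-cycles ⟩
      map h (cycles π) ++ map (cycleOf σ) (filterᵇ (isCycleMin σ) [ N ]) ∎
      where
      old-cycles : map (cycleOf σ) (filterᵇ (isCycleMin σ) (oneTo n)) ≡ map h (cycles π)
      old-cycles = begin
        map (cycleOf σ) (filterᵇ (isCycleMin σ) (oneTo n))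
          ≡⟨ cong (map (cycleOf σ)) (filterᵇ-cong∈ (oneTo n) isCycleMin-σ) ⟩
        map (cycleOf σ) (filterᵇ (isCycleMin π) (oneTo n))
          ≡⟨ map-cong∈ _ (λ m → cycleOf-σ (proj₁ (filterᵇ-∈⁻ (isCycleMin π) (oneTo n) m))) ⟩
        map (h ∘ cycleOf π) (filterᵇ (isCycleMin π) (oneTo n))
          ≡⟨ trans (LP.map-∘ _) (cong (map h ∘ map (cycleOf π)) (sym minima≡)) ⟩
        map h (cycles π) ∎

    fix-extension : (σ : List ℕ) → length σ ≡ N → fix σ ≡ countᵇ (λ x → app σ x ≡ᵇ x) (oneTo n) + b2n (app σ N ≡ᵇ N)
    fix-extension σ length-σ = begin
      countᵇ q (oneTo (length σ))          ≡⟨ cong (countᵇ q) (trans (cong oneTo length-σ) (oneTo-suc n)) ⟩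
      countᵇ q (oneTo n ++ [ N ])          ≡⟨ countᵇ-++ q (oneTo n) [ N ] ⟩
      countᵇ q (oneTo n) + countᵇ q [ N ]  ≡⟨ cong (countᵇ q (oneTo n) +_) (trans (countᵇ-∷ q N []) (NP.+-identityʳ _)) ⟩
      countᵇ q (oneTo n) + b2n (q N)       ∎
      where
      q : ℕ → Bool
      q x = app σ x ≡ᵇ x

    fix-π : fix π ≡ countᵇ (λ x → f x ≡ᵇ x) (oneTo n)
    fix-π = cong (λ l → countᵇ (λ x → f x ≡ᵇ x) (oneTo l)) length-π

    σ₀ : List ℕ
    σ₀ = π ++ [ N ]

    length-σ₀ : length σ₀ ≡ N
    length-σ₀ = trans (LP.length-++ π) (trans (NP.+-comm (length π) 1) (cong suc length-π))

    app-σ₀ : ∀ {x} → Dom x → app σ₀ x ≡ f x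
    app-σ₀ r with Dom⁻ r
    ... | k , refl , lt = app-++ˡ π [ N ] k (subst (k <_) (sym length-π) lt)

    app-σ₀-N : app σ₀ N ≡ N
    app-σ₀-N = subst (λ z → app σ₀ (suc z) ≡ N) (trans (NP.+-identityʳ (length π)) length-π) (app-++ʳ π [ N ] 0)

    cycleOf-σ₀ : ∀ {j} → Dom j → cycleOf σ₀ j ≡ cycleOf π j
    cycleOf-σ₀ {j} rj with cycleOf-orbit j rj
    ... | L , w , u@(j∉L ∷ _) , a@(_ ∷ aL) , e = trans (cycleOf-walk σ₀ w₀ (λ m → All.lookup j∉L m refl) length-L) (sym e)
      where
      w₀ : Walk (app σ₀) (app σ₀ j) L j
      w₀ = subst (λ z → Walk (app σ₀) z L j) (sym (app-σ₀ rj)) (walk-transfer w (λ m → app-σ₀ (All.lookup aL m)))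
      length-L : length L ≤ length σ₀
      length-L = subst (length L ≤_) (sym length-σ₀) (NP.<⇒≤ (orbit-length u a))

    cycleOf-σ₀-N : cycleOf σ₀ N ≡ [ N ]
    cycleOf-σ₀-N = begin
      N ∷ orbitFrom (length σ₀) σ₀ N (app σ₀ N) ≡⟨ cong₂ (λ l z → N ∷ orbitFrom l σ₀ N z) length-σ₀ app-σ₀-N ⟩
      N ∷ orbitFrom (suc n) σ₀ N N              ≡⟨ cong (λ b → N ∷ (if b then [] else N ∷ orbitFrom n σ₀ N (app σ₀ N))) (≡ᵇ-refl N) ⟩
      [ N ]                                     ∎

    cycles-σ₀ : cycles σ₀ ≡ cycles π ++ [ [ N ] ]
    cycles-σ₀ = trans (cycles-extension σ₀ id length-σ₀ cycleOf-σ₀ (cong (allᵇ _) ∘ cycleOf-σ₀)) (cong₂ _++_ (LP.map-id _) new-cycle)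
      where
      new-cycle : map (cycleOf σ₀) (filterᵇ (isCycleMin σ₀) [ N ]) ≡ [ [ N ] ]
      new-cycle with isCycleMin σ₀ N in eq
      ... | true = cong [_] cycleOf-σ₀-N
      ... | false with () ← trans (sym eq) (trans (cong (allᵇ (N ≤ᵇ_)) cycleOf-σ₀-N) (cong (_∧ true) (≤⇒≤ᵇ-true (NP.≤-refl {N}))))

    cyc-σ₀ : cyc σ₀ ≡ cyc π + 1
    cyc-σ₀ = trans (cong length cycles-σ₀) (LP.length-++ (cycles π))

    fix-σ₀ : fix σ₀ ≡ fix π + 1
    fix-σ₀ = begin
      fix σ₀ ≡⟨ fix-extension σ₀ length-σ₀ ⟩
      countᵇ (λ x → app σ₀ x ≡ᵇ x) (oneTo n) + b2n (app σ₀ N ≡ᵇ N)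
        ≡⟨ cong₂ _+_ (countᵇ-cong∈ (oneTo n) (λ m → cong (_≡ᵇ _) (app-σ₀ m)))
                     (cong b2n (trans (cong (_≡ᵇ N) app-σ₀-N) (≡ᵇ-refl N))) ⟩
      countᵇ (λ x → f x ≡ᵇ x) (oneTo n) + 1 ≡⟨ cong (_+ 1) (sym fix-π) ⟩
      fix π + 1 ∎

    cpk-σ₀ : cpk σ₀ ≡ cpk π
    cpk-σ₀ = begin
      sumℕ (map pk (cycles σ₀))             ≡⟨ cong (sumℕ ∘ map pk) cycles-σ₀ ⟩
      sumℕ (map pk (cycles π ++ [ [ N ] ])) ≡⟨ cong sumℕ (LP.map-++ pk (cycles π) [ [ N ] ]) ⟩
      sumℕ (map pk (cycles π) ++ [ 0 ])     ≡⟨ sum-++ (map pk (cycles π)) [ 0 ] ⟩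
      cpk π + 0                             ≡⟨ NP.+-identityʳ _ ⟩
      cpk π                                 ∎

    cycle-props : ∀ {C} → C ∈ cycles π → Unique C × All (_< N) C
    cycle-props {C} C∈ with ∈-cycles⁻ C∈
    ... | m , m∈ , e = subst (λ D → Unique D × All (_< N) D) (sym e)
                         (cycle-unique m (proj₁ (minima-∈⁻ m∈)) , All.map Dom⇒<N (cycle-range m (proj₁ (minima-∈⁻ m∈))))

    module Splice (p : ℕ) (p<n : p < n) where
      i : ℕ
      i = suc p

      σ : List ℕ
      σ = spliceAfter p N π

      Dom-i : Dom i
      Dom-i = ∈oneTo⁺ (s≤s z≤n) p<n

      Dom-fi : Dom (f i)
      Dom-fi = app-∈oneTo n isPerm Dom-i

      length-setAt-π : length (setAt p N π) ≡ n
      length-setAt-π = trans (length-setAt p N π) length-π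

      length-σ : length σ ≡ N
      length-σ = trans (LP.length-++ (setAt p N π)) (trans (NP.+-comm (length (setAt p N π)) 1) (cong suc length-setAt-π))

      app-σ : ∀ {x} → Dom x → x ≢ i → app σ x ≡ f x
      app-σ r x≢i with Dom⁻ r
      ... | k , refl , k<n = trans (app-++ˡ (setAt p N π) _ k (subst (k <_) (sym length-setAt-π) k<n))
                                   (app-setAt-≢ p N π k (x≢i ∘ cong suc))

      app-σ-i : app σ i ≡ N
      app-σ-i = trans (app-++ˡ (setAt p N π) _ p (subst (p <_) (sym length-setAt-π) p<n))
                      (app-setAt-≡ p N π (subst (p <_) (sym length-π) p<n))

      app-σ-N : app σ N ≡ f i
      app-σ-N = subst (λ z → app σ (suc z) ≡ f i) (trans (NP.+-identityʳ _) length-setAt-π)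
                      (app-++ʳ (setAt p N π) [ getAt p π ] 0)

      walk-σ : ∀ {k L m} → Walk f k L m → All Dom L → i ∉ L → Walk (app σ) k L m
      walk-σ w a i∉L = walk-transfer w (λ {x} x∈L → app-σ (All.lookup a x∈L) (λ x≡i → i∉L (subst (_∈ _) x≡i x∈L)))

      cycleOf-σ-walk : ∀ {j L} → Walk (app σ) (app σ j) L j → j ∉ L → length L ≤ N → cycleOf σ j ≡ j ∷ L
      cycleOf-σ-walk w j∉L le = cycleOf-walk σ w j∉L (subst (_ ≤_) (sym length-σ) le)

      cycleOf-σ-i : ∀ {L} → Walk f (f i) L i → Unique (i ∷ L) → All Dom (i ∷ L) → cycleOf σ i ≡ insertAfter i N (i ∷ L)
      cycleOf-σ-i {L} w u@(i≢L ∷ _) a@(_ ∷ aL) = begin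
        cycleOf σ i             ≡⟨ cycleOf-σ-walk wσ i∉NL (orbit-length u a) ⟩
        i ∷ N ∷ L               ≡⟨ cong (λ b → if b then i ∷ N ∷ L else i ∷ insertAfter i N L) (sym (≡ᵇ-refl i)) ⟩
        insertAfter i N (i ∷ L) ∎
        where
        i∉L : i ∉ L
        i∉L m = All.lookup i≢L m refl
        i∉NL : i ∉ N ∷ L
        i∉NL (here e) = Dom⇒≢N Dom-i e
        i∉NL (there m) = i∉L m
        wσ : Walk (app σ) (app σ i) (N ∷ L) i
        wσ = subst (λ z → Walk (app σ) z (N ∷ L) i) (sym app-σ-i)
               (wcons (subst (λ z → Walk (app σ) z L i) (sym app-σ-N) (walk-σ w aL i∉L)))

      cycleOf-σ-avoiding : ∀ {j L} → Dom j → j ≢ i → Walk f (f j) L j → Unique (j ∷ L) → All Dom (j ∷ L) → i ∉ L →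
                           cycleOf σ j ≡ insertAfter i N (j ∷ L)
      cycleOf-σ-avoiding {j} {L} rj j≢i w u@(j≢L ∷ _) a@(_ ∷ aL) i∉L = begin
        cycleOf σ j             ≡⟨ cycleOf-σ-walk wσ (λ m → All.lookup j≢L m refl) (NP.<⇒≤ (orbit-length u a)) ⟩
        j ∷ L                   ≡⟨ sym (insertAfter-∉ i N (j ∷ L) i∉jL) ⟩
        insertAfter i N (j ∷ L) ∎
        where
        wσ : Walk (app σ) (app σ j) L j
        wσ = subst (λ z → Walk (app σ) z L j) (sym (app-σ rj j≢i)) (walk-σ w aL i∉L)
        i∉jL : i ∉ j ∷ L
        i∉jL (here e) = j≢i (sym e)
        i∉jL (there m) = i∉L m

      cycleOf-σ-through : ∀ {j} A B → Dom j → j ≢ i → Walk f (f j) (A ++ i ∷ B) j →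
                          Unique (j ∷ A ++ i ∷ B) → All Dom (j ∷ A ++ i ∷ B) →
                          cycleOf σ j ≡ insertAfter i N (j ∷ A ++ i ∷ B)
      cycleOf-σ-through {j} A B rj j≢i w u@(j≢AB ∷ uAB) a@(_ ∷ aL) = begin
        cycleOf σ j                      ≡⟨ cycleOf-σ-walk wσ j∉ length-AiNB ⟩
        j ∷ A ++ i ∷ N ∷ B               ≡⟨ cong (j ∷_) (sym (insertAfter-split i N A B i∉A)) ⟩
        j ∷ insertAfter i N (A ++ i ∷ B) ≡⟨ cong (λ b → if b then j ∷ N ∷ A ++ i ∷ B else j ∷ insertAfter i N (A ++ i ∷ B))
                                                 (sym (≢⇒≡ᵇ-false j≢i)) ⟩
        insertAfter i N (j ∷ A ++ i ∷ B) ∎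
        where
        i∉A : i ∉ A
        i∉A m = unique-++⇒≢ A uAB m (here refl) refl
        i∉B : i ∉ B
        i∉B m with unique-++ʳ A uAB
        ... | i≢B ∷ _ = All.lookup i≢B m refl
        aA : All Dom A
        aA = AllP.++⁻ˡ A aL
        aB : All Dom B
        aB with AllP.++⁻ʳ A aL
        ... | _ ∷ aB = aB
        wσ : Walk (app σ) (app σ j) (A ++ i ∷ N ∷ B) j
        wσ with walk-split A w
        ... | _ , wA , wB with walk-start wB
        ... | refl = subst (λ z → Walk (app σ) z _ j) (sym (app-σ rj j≢i))
                       (walk-++ (walk-σ wA aA i∉A)
                         (wcons (subst (λ z → Walk (app σ) z (N ∷ B) j) (sym app-σ-i)
                           (wcons (subst (λ z → Walk (app σ) z B j) (sym app-σ-N) (walk-σ (walk-tail wB) aB i∉B))))))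
        j∉ : j ∉ A ++ i ∷ N ∷ B
        j∉ m with ∈-++⁻ A m
        ... | inj₁ mA = All.lookup j≢AB (∈-++⁺ˡ mA) refl
        ... | inj₂ (here e) = j≢i e
        ... | inj₂ (there (here e)) = Dom⇒≢N rj e
        ... | inj₂ (there (there mB)) = All.lookup j≢AB (∈-++⁺ʳ A (there mB)) refl
        length-AiNB : length (A ++ i ∷ N ∷ B) ≤ N
        length-AiNB = subst (_≤ N) (sym (trans (LP.length-++ A) (trans (NP.+-suc (length A) _) (cong suc (sym (LP.length-++ A))))))
                        (orbit-length u a)

      cycleOf-σ-orbit : ∀ {j L} → Dom j → Walk f (f j) L j → Unique (j ∷ L) → All Dom (j ∷ L) →
                        cycleOf σ j ≡ insertAfter i N (j ∷ L)
      cycleOf-σ-orbit {j} {L} rj w u a with j ℕ.≟ i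
      ... | yes refl = cycleOf-σ-i w u a
      ... | no j≢i with i ∈? L
      ...   | no i∉L = cycleOf-σ-avoiding rj j≢i w u a i∉L
      ...   | yes i∈L with ∈-∃++ i∈L
      ...     | A , B , refl = cycleOf-σ-through A B rj j≢i w u a

      cycleOf-σ : ∀ {j} → Dom j → cycleOf σ j ≡ insertAfter i N (cycleOf π j)
      cycleOf-σ {j} rj with cycleOf-orbit j rj
      ... | L , w , u , a , e = trans (cycleOf-σ-orbit rj w u a) (cong (insertAfter i N) (sym e))

      cycleOf-σ-N : ∃ λ rest → cycleOf σ N ≡ N ∷ f i ∷ rest
      cycleOf-σ-N = _ , (begin
        N ∷ orbitFrom (length σ) σ N (app σ N) ≡⟨ cong₂ (λ l z → N ∷ orbitFrom l σ N z) length-σ app-σ-N ⟩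
        N ∷ orbitFrom (suc n) σ N (f i)        ≡⟨ cong (λ b → N ∷ (if b then [] else f i ∷ orbitFrom n σ N (app σ (f i))))
                                                        (≢⇒≡ᵇ-false (Dom⇒≢N Dom-fi)) ⟩
        N ∷ f i ∷ orbitFrom n σ N (app σ (f i)) ∎)

      isCycleMin-σ-N : isCycleMin σ N ≡ false
      isCycleMin-σ-N with cycleOf-σ-N
      ... | rest , e = trans (cong (allᵇ (N ≤ᵇ_)) e)
                             (cong₂ (λ a b → a ∧ (b ∧ allᵇ (N ≤ᵇ_) rest)) (≤⇒≤ᵇ-true (NP.≤-refl {N})) (>⇒≤ᵇ-false (Dom⇒<N Dom-fi)))

      isCycleMin-σ : ∀ {x} → Dom x → isCycleMin σ x ≡ isCycleMin π x
      isCycleMin-σ {x} r = trans (cong (allᵇ (x ≤ᵇ_)) (cycleOf-σ r))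
                                 (allᵇ-insertAfter (x ≤ᵇ_) i N (cycleOf π x) (≤⇒≤ᵇ-true (NP.<⇒≤ (Dom⇒<N r))))

      cycles-σ : cycles σ ≡ map (insertAfter i N) (cycles π)
      cycles-σ = trans (cycles-extension σ (insertAfter i N) length-σ cycleOf-σ isCycleMin-σ)
                       (trans (cong (map (insertAfter i N) (cycles π) ++_) no-new-cycle) (LP.++-identityʳ _))
        where
        no-new-cycle : map (cycleOf σ) (filterᵇ (isCycleMin σ) [ N ]) ≡ []
        no-new-cycle rewrite isCycleMin-σ-N = refl

      cyc-σ : cyc σ ≡ cyc π
      cyc-σ = trans (cong length cycles-σ) (LP.length-map (insertAfter i N) (cycles π))

      fix-σ : fix σ + b2n (f i ≡ᵇ i) ≡ fix π
      fix-σ = begin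
        fix σ + b2n (qπ i)                            ≡⟨ cong (_+ b2n (qπ i)) (fix-extension σ length-σ) ⟩
        countᵇ qσ (oneTo n) + b2n (qσ N) + b2n (qπ i) ≡⟨ cong (λ b → countᵇ qσ (oneTo n) + b2n b + b2n (qπ i)) qσ-N ⟩
        countᵇ qσ (oneTo n) + 0 + b2n (qπ i)          ≡⟨ cong (_+ b2n (qπ i)) (NP.+-identityʳ _) ⟩
        countᵇ qσ (oneTo n) + b2n (qπ i)              ≡⟨ countᵇ-update qσ qπ (oneTo n) (oneTo-unique n) Dom-i
                                                            (λ m x≢i → cong (_≡ᵇ _) (app-σ m x≢i)) ⟩
        countᵇ qπ (oneTo n) + b2n (qσ i)              ≡⟨ cong (λ b → countᵇ qπ (oneTo n) + b2n b) qσ-i ⟩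
        countᵇ qπ (oneTo n) + 0                       ≡⟨ trans (NP.+-identityʳ _) (sym fix-π) ⟩
        fix π                                         ∎
        where
        qσ qπ : ℕ → Bool
        qσ x = app σ x ≡ᵇ x
        qπ x = f x ≡ᵇ x
        qσ-N : qσ N ≡ false
        qσ-N = trans (cong (_≡ᵇ N) app-σ-N) (≢⇒≡ᵇ-false (Dom⇒≢N Dom-fi))
        qσ-i : qσ i ≡ false
        qσ-i = trans (cong (_≡ᵇ i) app-σ-i) (≢⇒≡ᵇ-false (Dom⇒≢N Dom-i ∘ sym))

      cpk-σ : ∀ {C} → C ∈ cycles π → i ∈ C → cpk σ + pk C ≡ cpk π + pk (insertAfter i N C)
      cpk-σ {C} C∈ i∈C = trans (cong (λ Cs → sumℕ Cs + pk C) (trans (cong (map pk) cycles-σ) (sym (LP.map-∘ {g = pk} {f = insertAfter i N} (cycles π)))))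
                               (sum-insertAfter N i (cycles π) concat-cycles-unique C∈ i∈C)

      cycle-through-i : ∃ λ C → C ∈ cycles π × i ∈ C
      cycle-through-i = let C , i∈C , C∈ = ∈-concat⁻′ (cycles π) (∈-resp-↭ (↭-sym partition) Dom-i) in C , C∈ , i∈C

      fixed⇒singleton-cycle : f i ≡ i → cycleOf π i ≡ [ i ]
      fixed⇒singleton-cycle fi≡i with cycleOf-orbit i Dom-i
      ... | [] , _ , _ , _ , e = e
      ... | x ∷ L , w , (i≢xL ∷ _) , _ , _ with walk-start w
      ... | fi≡x = ⊥-elim (All.lookup i≢xL (here (trans (sym fi≡i) fi≡x)) refl)

      Classification : Set
      Classification = (f i ≡ i × fix σ + 1 ≡ fix π × cpk σ ≡ cpk π)
                     ⊎ (f i ≢ i × fix σ ≡ fix π × (cpk σ ≡ cpk π ⊎ cpk σ ≡ suc (cpk π)))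

      classify-via : ∀ {C} → C ∈ cycles π → i ∈ C → Classification
      classify-via {C} C∈ i∈C with f i ℕ.≟ i
      ... | yes fi≡i = inj₁ (fi≡i , fix-eq , cpk-eq)
        where
        fix-eq : fix σ + 1 ≡ fix π
        fix-eq = trans (cong (λ b → fix σ + b2n b) (sym (trans (cong (_≡ᵇ i) fi≡i) (≡ᵇ-refl i)))) fix-σ
        C≡[i] : C ≡ [ i ]
        C≡[i] with ∈-cycles⁻ C∈
        ... | m , m∈ , e = trans e (↭-singleton-inv (subst (cycleOf π m ↭_) (fixed⇒singleton-cycle fi≡i)
                                     (↭-sym (cycleOf-rotate m (proj₁ (minima-∈⁻ m∈)) (subst (i ∈_) e i∈C)))))
        cpk-eq : cpk σ ≡ cpk π
        cpk-eq = NP.+-cancelʳ-≡ 0 (cpk σ) (cpk π) (begin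
          cpk σ + 0                          ≡⟨ cong (λ D → cpk σ + pk D) (sym C≡[i]) ⟩
          cpk σ + pk C                       ≡⟨ cpk-σ C∈ i∈C ⟩
          cpk π + pk (insertAfter i N C)     ≡⟨ cong (λ D → cpk π + pk (insertAfter i N D)) C≡[i] ⟩
          cpk π + pk (insertAfter i N [ i ]) ≡⟨ cong (λ b → cpk π + pk (if b then i ∷ N ∷ [] else i ∷ [])) (≡ᵇ-refl i) ⟩
          cpk π + 0                          ∎)
      ... | no fi≢i = inj₂ (fi≢i , fix-eq , cpk-eq)
        where
        fix-eq : fix σ ≡ fix π
        fix-eq = trans (sym (NP.+-identityʳ (fix σ))) (trans (cong (λ b → fix σ + b2n b) (sym (≢⇒≡ᵇ-false fi≢i))) fix-σ)
        cpk-eq : cpk σ ≡ cpk π ⊎ cpk σ ≡ suc (cpk π)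
        cpk-eq with cycle-props C∈
        ... | uC , C<N with insertAfter-peaks N C uC C<N i∈C
        ... | inj₁ e = inj₁ (NP.+-cancelʳ-≡ (pk C) (cpk σ) (cpk π) (trans (cpk-σ C∈ i∈C) (cong (cpk π +_) e)))
        ... | inj₂ e = inj₂ (NP.+-cancelʳ-≡ (pk C) (cpk σ) (suc (cpk π)) (trans (cpk-σ C∈ i∈C) (trans (cong (cpk π +_) e) (NP.+-suc _ _))))

      -- abstract, so that matching on classify does not unfold the cycle decomposition of π.
      abstract
        classify : Classification
        classify = let C , C∈ , i∈C = cycle-through-i in classify-via C∈ i∈C

open Combinatorics

module WeightedSums where

  open import Data.Integer as ℤ using (ℤ; +_; +0; _+_; _*_; _-_)
  import Data.Integer.Properties as ZP
  import Data.Integer.Tactic.RingSolver as ZS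

  sumℤ : List ℤ → ℤ
  sumℤ = foldr _+_ +0

  ΣL : {A : Set} → List A → (A → ℤ) → ℤ
  ΣL L f = sumℤ (map f L)

  sumBelow : ℕ → (ℕ → ℤ) → ℤ
  sumBelow zero g = +0
  sumBelow (suc m) g = g 0 + sumBelow m (λ p → g (suc p))

  ΣL-++ : {A : Set} (xs ys : List A) (f : A → ℤ) → ΣL (xs ++ ys) f ≡ ΣL xs f + ΣL ys f
  ΣL-++ [] ys f = sym (ZP.+-identityˡ _)
  ΣL-++ (x ∷ xs) ys f = trans (cong (_+_ (f x)) (ΣL-++ xs ys f)) (sym (ZP.+-assoc (f x) _ _))

  ΣL-concatMap : {A B : Set} (h : A → List B) (xs : List A) (f : B → ℤ) → ΣL (concatMap h xs) f ≡ ΣL xs (λ a → ΣL (h a) f)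
  ΣL-concatMap h [] f = refl
  ΣL-concatMap h (x ∷ xs) f = trans (ΣL-++ (h x) (concatMap h xs) f) (cong (_+_ (ΣL (h x) f)) (ΣL-concatMap h xs f))

  ΣL-↭ : {A : Set} {xs ys : List A} (f : A → ℤ) → xs ↭ ys → ΣL xs f ≡ ΣL ys f
  ΣL-↭ f p = ↭ₛ.foldr-commMonoid (setoid ℤ) ZP.+-0-isCommutativeMonoid (↭⇒↭ₛ (↭-map⁺ f p))

  ΣL-map : {A B : Set} (h : A → B) (xs : List A) (f : B → ℤ) → ΣL (map h xs) f ≡ ΣL xs (λ a → f (h a))
  ΣL-map h [] f = refl
  ΣL-map h (x ∷ xs) f = cong (_+_ (f (h x))) (ΣL-map h xs f)

  ΣL-cong : {A : Set} (xs : List A) {f g : A → ℤ} → (∀ {a} → a ∈ xs → f a ≡ g a) → ΣL xs f ≡ ΣL xs g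
  ΣL-cong [] h = refl
  ΣL-cong (x ∷ xs) h = cong₂ _+_ (h (here refl)) (ΣL-cong xs (λ m → h (there m)))

  ΣL-+ : {A : Set} (xs : List A) (f g : A → ℤ) → ΣL xs (λ a → f a + g a) ≡ ΣL xs f + ΣL xs g
  ΣL-+ [] f g = refl
  ΣL-+ (x ∷ xs) f g = trans (cong (_+_ (f x + g x)) (ΣL-+ xs f g)) (rearrange (f x) (g x) (ΣL xs f) (ΣL xs g))
    where
    rearrange : ∀ a b c d → (a + b) + (c + d) ≡ (a + c) + (b + d)
    rearrange = ZS.solve-∀

  ΣL-zero : {A : Set} (L : List A) → +0 ≡ ΣL L (λ _ → +0)
  ΣL-zero [] = refl
  ΣL-zero (x ∷ L) = trans (ΣL-zero L) (sym (ZP.+-identityˡ _))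

  ΣL-scale : {A : Set} (L : List A) (m : ℤ) (g : A → ℤ) → m * ΣL L g ≡ ΣL L (λ x → m * g x)
  ΣL-scale [] m g = ZP.*-zeroʳ m
  ΣL-scale (x ∷ L) m g = trans (ZP.*-distribˡ-+ m (g x) _) (cong (_+_ (m * g x)) (ΣL-scale L m g))

  sumBelow-applyUpTo : ∀ m g → sumℤ (applyUpTo g m) ≡ sumBelow m g
  sumBelow-applyUpTo zero g = refl
  sumBelow-applyUpTo (suc m) g = cong (_+_ (g 0)) (sumBelow-applyUpTo m (λ p → g (suc p)))

  sumBelow-suc : ∀ m g → sumBelow (suc m) g ≡ sumBelow m g + g m
  sumBelow-suc zero g = trans (ZP.+-identityʳ (g 0)) (sym (ZP.+-identityˡ (g 0)))
  sumBelow-suc (suc m) g = begin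
    g 0 + sumBelow (suc m) (λ p → g (suc p)) ≡⟨ cong (_+_ (g 0)) (sumBelow-suc m (λ p → g (suc p))) ⟩
    g 0 + (sumBelow m (λ p → g (suc p)) + g (suc m)) ≡⟨ sym (ZP.+-assoc (g 0) _ _) ⟩
    (g 0 + sumBelow m (λ p → g (suc p))) + g (suc m) ∎

  sumBelow-cong : ∀ m {f g} → (∀ p → p < m → f p ≡ g p) → sumBelow m f ≡ sumBelow m g
  sumBelow-cong zero h = refl
  sumBelow-cong (suc m) h = cong₂ _+_ (h 0 (s≤s z≤n)) (sumBelow-cong m (λ p lt → h (suc p) (s≤s lt)))

  ΣL-sumBelow : {A : Set} (xs : List A) (m : ℕ) (f : A → ℕ → ℤ) → ΣL xs (λ a → sumBelow m (f a)) ≡ sumBelow m (λ p → ΣL xs (λ a → f a p))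
  ΣL-sumBelow xs zero f = sym (ΣL-zero xs)
  ΣL-sumBelow xs (suc m) f = trans (ΣL-+ xs (λ a → f a 0) (λ a → sumBelow m (λ p → f a (suc p))))
    (cong (_+_ (ΣL xs (λ a → f a 0))) (ΣL-sumBelow xs m (λ a p → f a (suc p))))

  insAt-end : ∀ x π → insAt (length π) x π ≡ π ++ [ x ]
  insAt-end x [] = refl
  insAt-end x (y ∷ ys) = cong (y ∷_) (insAt-end x ys)

  ΣL-perms-suc-split : ∀ n (g : List ℕ → ℤ) →
    ΣL (perms (suc n)) g ≡ ΣL (perms n) (λ π → sumBelow n (λ p → g (spliceAfter p (suc n) π)) + g (π ++ [ suc n ]))
  ΣL-perms-suc-split n g = begin
    ΣL (perms (suc n)) g
      ≡⟨ ΣL-concatMap (insertAll (suc n)) (perms n) g ⟩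
    ΣL (perms n) (λ π → ΣL (insertAll (suc n) π) g)
      ≡⟨ ΣL-cong (perms n) sum-insertAll ⟩
    ΣL (perms n) (λ π → sumBelow n (λ p → g (insAt p (suc n) π)) + g (π ++ [ suc n ]))
      ≡⟨ ΣL-+ (perms n) _ _ ⟩
    ΣL (perms n) (λ π → sumBelow n (λ p → g (insAt p (suc n) π))) + ΣL (perms n) (λ π → g (π ++ [ suc n ]))
      ≡⟨ cong (_+ ΣL (perms n) (λ π → g (π ++ [ suc n ]))) (ΣL-sumBelow (perms n) n (λ π p → g (insAt p (suc n) π))) ⟩
    sumBelow n (λ p → ΣL (perms n) (λ π → g (insAt p (suc n) π))) + ΣL (perms n) (λ π → g (π ++ [ suc n ]))
      ≡⟨ cong (_+ ΣL (perms n) (λ π → g (π ++ [ suc n ]))) (sumBelow-cong n sum-insAt≡sum-splice) ⟩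
    sumBelow n (λ p → ΣL (perms n) (λ π → g (spliceAfter p (suc n) π))) + ΣL (perms n) (λ π → g (π ++ [ suc n ]))
      ≡⟨ cong (_+ ΣL (perms n) (λ π → g (π ++ [ suc n ]))) (sym (ΣL-sumBelow (perms n) n (λ π p → g (spliceAfter p (suc n) π)))) ⟩
    ΣL (perms n) (λ π → sumBelow n (λ p → g (spliceAfter p (suc n) π))) + ΣL (perms n) (λ π → g (π ++ [ suc n ]))
      ≡⟨ sym (ΣL-+ (perms n) _ _) ⟩
    ΣL (perms n) (λ π → sumBelow n (λ p → g (spliceAfter p (suc n) π)) + g (π ++ [ suc n ])) ∎
    where
    sum-insertAll : ∀ {π} → π ∈ perms n → ΣL (insertAll (suc n) π) g ≡ sumBelow n (λ p → g (insAt p (suc n) π)) + g (π ++ [ suc n ])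
    sum-insertAll {π} m = begin
      ΣL (insertAll (suc n) π) g ≡⟨ cong (λ L → ΣL L g) (insertAll≡insAt (suc n) π) ⟩
      ΣL (applyUpTo (λ p → insAt p (suc n) π) (suc (length π))) g ≡⟨ cong sumℤ (LP.map-applyUpTo (λ p → insAt p (suc n) π) g (suc (length π))) ⟩
      sumℤ (applyUpTo (λ p → g (insAt p (suc n) π)) (suc (length π))) ≡⟨ sumBelow-applyUpTo (suc (length π)) (λ p → g (insAt p (suc n) π)) ⟩
      sumBelow (suc (length π)) (λ p → g (insAt p (suc n) π)) ≡⟨ sumBelow-suc (length π) (λ p → g (insAt p (suc n) π)) ⟩
      sumBelow (length π) (λ p → g (insAt p (suc n) π)) + g (insAt (length π) (suc n) π)
        ≡⟨ cong₂ (λ a b → sumBelow a (λ p → g (insAt p (suc n) π)) + g b) len (insAt-end (suc n) π) ⟩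
      sumBelow n (λ p → g (insAt p (suc n) π)) + g (π ++ [ suc n ]) ∎
      where len = perm-length n (perms-sound n m)
    sum-insAt≡sum-splice : ∀ p → p < n → ΣL (perms n) (λ π → g (insAt p (suc n) π)) ≡ ΣL (perms n) (λ π → g (spliceAfter p (suc n) π))
    sum-insAt≡sum-splice p lt = begin
      ΣL (perms n) (λ π → g (insAt p (suc n) π))
        ≡⟨ ΣL-cong (perms n) (λ {π} m → cong g (insAt≡spliceAfter∘lastTo p (suc n) π (subst (p <_) (sym (perm-length n (perms-sound n m))) lt))) ⟩
      ΣL (perms n) (λ π → g (spliceAfter p (suc n) (lastTo p π))) ≡⟨ sym (ΣL-map (lastTo p) (perms n) _) ⟩
      ΣL (map (lastTo p) (perms n)) (λ π → g (spliceAfter p (suc n) π)) ≡⟨ ΣL-↭ _ (lastTo-perms n p lt) ⟩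
      ΣL (perms n) (λ π → g (spliceAfter p (suc n) π)) ∎

  ΣL-three-classes : ∀ (xs : List ℕ) (g : ℕ → ℤ) (a b : ℕ → Bool) (W1 W2 W3 : ℤ) →
    (∀ {i} → i ∈ xs → g i ≡ (if a i then W1 else if b i then W2 else W3)) →
    ΣL xs g ≡ + countᵇ a xs ℤ.* W1 ℤ.+ (+ countᵇ (λ i → not (a i) ∧ b i) xs ℤ.* W2 ℤ.+ + countᵇ (λ i → not (a i) ∧ not (b i)) xs ℤ.* W3)
  ΣL-three-classes [] g a b W1 W2 W3 h = refl
  ΣL-three-classes (x ∷ xs) g a b W1 W2 W3 h with a x in ea | b x in eb | h (here refl)
  ... | true | _ | hx rewrite hx | ΣL-three-classes xs g a b W1 W2 W3 (λ m → h (there m)) = rearrange W1 (+ countᵇ a xs) (+ countᵇ (λ i → not (a i) ∧ b i) xs ℤ.* W2 ℤ.+ + countᵇ (λ i → not (a i) ∧ not (b i)) xs ℤ.* W3)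
    where
    rearrange : ∀ w c r → w ℤ.+ (c ℤ.* w ℤ.+ r) ≡ (ℤ.+ 1 ℤ.+ c) ℤ.* w ℤ.+ r
    rearrange = ZS.solve-∀
  ... | false | true | hx rewrite hx | ΣL-three-classes xs g a b W1 W2 W3 (λ m → h (there m)) = rearrange W2 (+ countᵇ a xs ℤ.* W1) (+ countᵇ (λ i → not (a i) ∧ b i) xs) (+ countᵇ (λ i → not (a i) ∧ not (b i)) xs ℤ.* W3)
    where
    rearrange : ∀ w p c r → w ℤ.+ (p ℤ.+ (c ℤ.* w ℤ.+ r)) ≡ p ℤ.+ ((ℤ.+ 1 ℤ.+ c) ℤ.* w ℤ.+ r)
    rearrange = ZS.solve-∀
  ... | false | false | hx rewrite hx | ΣL-three-classes xs g a b W1 W2 W3 (λ m → h (there m)) = rearrange W3 (+ countᵇ a xs ℤ.* W1) (+ countᵇ (λ i → not (a i) ∧ b i) xs ℤ.* W2) (+ countᵇ (λ i → not (a i) ∧ not (b i)) xs)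
    where
    rearrange : ∀ w p q c → w ℤ.+ (p ℤ.+ (q ℤ.+ c ℤ.* w)) ≡ p ℤ.+ (q ℤ.+ (ℤ.+ 1 ℤ.+ c) ℤ.* w)
    rearrange = ZS.solve-∀

  count-three-classes : ∀ (xs : List ℕ) (a b : ℕ → Bool) →
    countᵇ a xs ℕ.+ countᵇ (λ i → not (a i) ∧ b i) xs ℕ.+ countᵇ (λ i → not (a i) ∧ not (b i)) xs ≡ length xs
  count-three-classes [] a b = refl
  count-three-classes (x ∷ xs) a b
    rewrite countᵇ-∷ a x xs | countᵇ-∷ (λ i → not (a i) ∧ b i) x xs | countᵇ-∷ (λ i → not (a i) ∧ not (b i)) x xs =
    trans (rearrange (b2n (a x)) (b2n (not (a x) ∧ b x)) (b2n (not (a x) ∧ not (b x))) _ _ _)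
      (cong₂ ℕ._+_ (exactly-one (a x) (b x)) (count-three-classes xs a b))
    where
    rearrange : ∀ u v w A B C → (u ℕ.+ A) ℕ.+ (v ℕ.+ B) ℕ.+ (w ℕ.+ C) ≡ (u ℕ.+ v ℕ.+ w) ℕ.+ (A ℕ.+ B ℕ.+ C)
    rearrange = NS.solve-∀
    exactly-one : ∀ p q → b2n p ℕ.+ b2n (not p ∧ q) ℕ.+ b2n (not p ∧ not q) ≡ 1
    exactly-one true q = refl
    exactly-one false true = refl
    exactly-one false false = refl

  count-exclusive : ∀ (xs : List ℕ) (a b : ℕ → Bool) → (∀ {i} → i ∈ xs → a i ≡ true → b i ≡ false) →
    countᵇ (λ i → not (a i) ∧ b i) xs ≡ countᵇ b xs
  count-exclusive xs a b h = countᵇ-cong∈ xs λ {i} m → not-a∧b≡b i m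
    where
    not-a∧b≡b : ∀ i → i ∈ xs → (not (a i) ∧ b i) ≡ b i
    not-a∧b≡b i m with a i in ea
    ... | true = sym (h m ea)
    ... | false = refl

  cong₃ : ∀ (g : ℕ → ℕ → ℕ → ℤ) {a a' b b' c c'} → a ≡ a' → b ≡ b' → c ≡ c' → g a b c ≡ g a' b' c'
  cong₃ g refl refl refl = refl

  if-true : ∀ {A : Set} {b} {x y : A} → b ≡ true → x ≡ (if b then x else y)
  if-true refl = refl

  if-false : ∀ {A : Set} {b} {x y : A} → b ≡ false → y ≡ (if b then x else y)
  if-false refl = refl

  raisingCount neutralCount : ℕ → List ℕ → ℕ
  raisingCount n π = countᵇ (λ i → cpk (spliceAfter (i ∸ 1) (suc n) π) ≡ᵇ suc (cpk π)) (oneTo n)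
  neutralCount n π = countᵇ (λ i → not (app π i ≡ᵇ i) ∧ not (cpk (spliceAfter (i ∸ 1) (suc n) π) ≡ᵇ suc (cpk π))) (oneTo n)

  contribution : ℕ → List ℕ → (ℕ → ℕ → ℕ → ℤ) → ℤ
  contribution n π w =
    (+ fix π ℤ.* w (cpk π) (cyc π) (fix π ∸ 1) ℤ.+ (+ raisingCount n π ℤ.* w (suc (cpk π)) (cyc π) (fix π) ℤ.+ + neutralCount n π ℤ.* w (cpk π) (cyc π) (fix π)))
    ℤ.+ w (cpk π) (cyc π ℕ.+ 1) (fix π ℕ.+ 1)

  module Contribution (n : ℕ) (π : List ℕ) (isPerm : Perm n π) where
    open Cycles n π isPerm
    open Decomposition n π isPerm
    open Extension n π isPerm

    k y f0 : ℕ
    k = cpk π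
    y = cyc π
    f0 = fix π

    spliced : ℕ → List ℕ
    spliced i = spliceAfter (i ∸ 1) N π

    isFixed raises : ℕ → Bool
    isFixed i = app π i ≡ᵇ i
    raises i = cpk (spliced i) ≡ᵇ suc k

    raising neutral : ℕ
    raising = raisingCount n π
    neutral = neutralCount n π

    weight-spliced : ∀ (w : ℕ → ℕ → ℕ → ℤ) {i} → Dom i →
      w (cpk (spliced i)) (cyc (spliced i)) (fix (spliced i)) ≡ (if isFixed i then w k y (f0 ∸ 1) else if raises i then w (suc k) y f0 else w k y f0)
    weight-spliced w {i} r with Dom⁻ r
    ... | p , refl , lt with Splice.classify p lt
    ... | inj₁ (fi , fxe , cpe) =
          trans (cong₃ w cpe (Splice.cyc-σ p lt) (sym (trans (cong (_∸ 1) (sym fxe)) (NP.m+n∸n≡m _ 1))))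
                   (if-true (trans (cong (_≡ᵇ suc p) fi) (≡ᵇ-refl (suc p))))
    ... | inj₂ (nfi , fxe , inj₁ cpe) =
          trans (cong₃ w cpe (Splice.cyc-σ p lt) fxe)
            (trans (if-false (trans (cong (_≡ᵇ suc k) cpe) (≢⇒≡ᵇ-false {k} {suc k} (λ e → NP.<-irrefl e (NP.n<1+n k))))) (if-false (≢⇒≡ᵇ-false nfi)))
    ... | inj₂ (nfi , fxe , inj₂ cpe) =
          trans (cong₃ w cpe (Splice.cyc-σ p lt) fxe)
            (trans (if-true (trans (cong (_≡ᵇ suc k) cpe) (≡ᵇ-refl (suc k)))) (if-false (≢⇒≡ᵇ-false nfi)))

    fixed⇒¬raises : ∀ {i} → i ∈ oneTo n → isFixed i ≡ true → raises i ≡ false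
    fixed⇒¬raises {i} r e with Dom⁻ r
    ... | p , refl , lt with Splice.classify p lt
    ... | inj₁ (fi , fxe , cpe) = trans (cong (_≡ᵇ suc k) cpe) (≢⇒≡ᵇ-false {k} {suc k} (λ e → NP.<-irrefl e (NP.n<1+n k)))
    ... | inj₂ (nfi , _ , _) with () ← trans (sym e) (≢⇒≡ᵇ-false nfi)

    count-isFixed : countᵇ isFixed (oneTo n) ≡ f0
    count-isFixed = cong (λ l → countᵇ isFixed (oneTo l)) (sym length-π)

    ΣL-spliced : ∀ (w : ℕ → ℕ → ℕ → ℤ) → ΣL (oneTo n) (λ i → w (cpk (spliced i)) (cyc (spliced i)) (fix (spliced i))) ≡
      + f0 ℤ.* w k y (f0 ∸ 1) ℤ.+ (+ raising ℤ.* w (suc k) y f0 ℤ.+ + neutral ℤ.* w k y f0)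
    ΣL-spliced w = trans (ΣL-three-classes (oneTo n) _ isFixed raises _ _ _ (weight-spliced w))
      (cong₂ (λ a b → + a ℤ.* w k y (f0 ∸ 1) ℤ.+ (+ b ℤ.* w (suc k) y f0 ℤ.+ + neutral ℤ.* w k y f0)) count-isFixed (count-exclusive (oneTo n) isFixed raises fixed⇒¬raises))

    fix+raising+neutral≡n : f0 ℕ.+ raising ℕ.+ neutral ≡ n
    fix+raising+neutral≡n = trans (cong₂ (λ a b → a ℕ.+ b ℕ.+ neutral) (sym count-isFixed) (sym (count-exclusive (oneTo n) isFixed raises fixed⇒¬raises)))
             (trans (count-three-classes (oneTo n) isFixed raises) (LP.length-applyUpTo suc n))

    raisingIn : List ℕ → ℕ
    raisingIn C = countᵇ (λ i → pk (insertAfter i N C) ≡ᵇ suc (pk C)) C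

    cycle-facts : ∀ {C} → C ∈ cycles π → Unique C × All Dom C × C ≢ []
    cycle-facts {C} mC with ∈-cycles⁻ mC
    ... | m , mm , e = subst (λ z → Unique z × All Dom z × z ≢ []) (sym e)
          (cycle-unique m (proj₁ (minima-∈⁻ mm)) , cycle-range m (proj₁ (minima-∈⁻ mm)) , λ ())

    raises≡raisingIn : ∀ {C} → C ∈ cycles π → ∀ {i} → i ∈ C → raises i ≡ (pk (insertAfter i N C) ≡ᵇ suc (pk C))
    raises≡raisingIn {C} mC {i} iC with Dom⁻ (All.lookup (proj₁ (proj₂ (cycle-facts mC))) iC)
    ... | p , refl , lt = ≡ᵇ-suc-shift (cpk (spliceAfter p N π)) (pk C) k (pk (insertAfter (suc p) N C)) (Splice.cpk-σ p lt mC iC)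

    raising+cyc+2cpk≡n : raising ℕ.+ y ℕ.+ 2 ℕ.* k ≡ n
    raising+cyc+2cpk≡n = begin
      raising ℕ.+ y ℕ.+ 2 ℕ.* k ≡⟨ cong (λ z → z ℕ.+ y ℕ.+ 2 ℕ.* k) raising≡sum-raisingIn ⟩
      sumℕ (map raisingIn Cs) ℕ.+ length Cs ℕ.+ 2 ℕ.* sumℕ (map pk Cs) ≡⟨ rearrange (sumℕ (map raisingIn Cs)) (length Cs) (sumℕ (map pk Cs)) ⟩
      sumℕ (map raisingIn Cs) ℕ.+ 2 ℕ.* sumℕ (map pk Cs) ℕ.+ length Cs ≡⟨ sym (split Cs) ⟩
      sumℕ (map (λ C → raisingIn C ℕ.+ 2 ℕ.* pk C ℕ.+ 1) Cs)
        ≡⟨ sumℕ-cong∈ Cs (λ {C} mC → raising-positions N C (proj₁ (cycle-facts mC)) (All.map Dom⇒<N (proj₁ (proj₂ (cycle-facts mC)))) (proj₂ (proj₂ (cycle-facts mC)))) ⟩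
      sumℕ (map length Cs) ≡⟨ sym (length-concat Cs) ⟩
      length (concat Cs) ≡⟨ ↭-length partition ⟩
      length (oneTo n) ≡⟨ LP.length-applyUpTo suc n ⟩
      n ∎
      where
      Cs = cycles π
      rearrange : ∀ a b c → a ℕ.+ b ℕ.+ 2 ℕ.* c ≡ a ℕ.+ 2 ℕ.* c ℕ.+ b
      rearrange = NS.solve-∀
      split : ∀ Ds → sumℕ (map (λ C → raisingIn C ℕ.+ 2 ℕ.* pk C ℕ.+ 1) Ds) ≡ sumℕ (map raisingIn Ds) ℕ.+ 2 ℕ.* sumℕ (map pk Ds) ℕ.+ length Ds
      split [] = refl
      split (D ∷ Ds) rewrite split Ds = rearrange₂ (raisingIn D) (pk D) (sumℕ (map raisingIn Ds)) (sumℕ (map pk Ds)) (length Ds)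
        where
        rearrange₂ : ∀ a b c d l → a ℕ.+ 2 ℕ.* b ℕ.+ 1 ℕ.+ (c ℕ.+ 2 ℕ.* d ℕ.+ l) ≡ a ℕ.+ c ℕ.+ 2 ℕ.* (b ℕ.+ d) ℕ.+ suc l
        rearrange₂ = NS.solve-∀
      raising≡sum-raisingIn : raising ≡ sumℕ (map raisingIn Cs)
      raising≡sum-raisingIn = begin
        countᵇ raises (oneTo n) ≡⟨ sym (countᵇ-↭ raises partition) ⟩
        countᵇ raises (concat Cs) ≡⟨ countᵇ-concat raises Cs ⟩
        sumℕ (map (countᵇ raises) Cs) ≡⟨ sumℕ-cong∈ Cs (λ mC → countᵇ-cong∈ _ (raises≡raisingIn mC)) ⟩
        sumℕ (map raisingIn Cs) ∎

    sum-extensions : ∀ (w : ℕ → ℕ → ℕ → ℤ) →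
      sumBelow n (λ p → w (cpk (spliceAfter p N π)) (cyc (spliceAfter p N π)) (fix (spliceAfter p N π))) ℤ.+ w (cpk σ₀) (cyc σ₀) (fix σ₀) ≡
      contribution n π w
    sum-extensions w = cong₂ ℤ._+_ (trans (sym (sumBelow-applyUpTo n g)) (trans (cong sumℤ (sym (LP.map-applyUpTo suc h n))) (ΣL-spliced w)))
                          (cong₃ w cpk-σ₀ cyc-σ₀ fix-σ₀)
      where
      g : ℕ → ℤ
      g p = w (cpk (spliceAfter p N π)) (cyc (spliceAfter p N π)) (fix (spliceAfter p N π))
      h : ℕ → ℤ
      h i = w (cpk (spliced i)) (cyc (spliced i)) (fix (spliced i))

  ΣL-perms-suc : ∀ n (w : ℕ → ℕ → ℕ → ℤ) → ΣL (perms (suc n)) (λ σ → w (cpk σ) (cyc σ) (fix σ)) ≡ ΣL (perms n) (λ π → contribution n π w)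
  ΣL-perms-suc n w = trans (ΣL-perms-suc-split n (λ σ → w (cpk σ) (cyc σ) (fix σ))) (ΣL-cong (perms n) (λ {π} m → Contribution.sum-extensions n π (perms-sound n m) w))

  counting-identities : ∀ n {π} → π ∈ perms n → (raisingCount n π ℕ.+ cyc π ℕ.+ 2 ℕ.* cpk π ≡ n) × (fix π ℕ.+ raisingCount n π ℕ.+ neutralCount n π ≡ n) × fix π ≤ n
  counting-identities n {π} π∈ =
    Contribution.raising+cyc+2cpk≡n n π isPerm ,
    Contribution.fix+raising+neutral≡n n π isPerm ,
    subst (fix π ≤_) (trans (LP.length-applyUpTo suc (length π)) (perm-length n isPerm)) (countᵇ-≤ _ (oneTo (length π)))
    where
    isPerm = perms-sound n π∈

open WeightedSums

module Recurrences where

  open import Data.Integer as ℤ using (ℤ; +_; +0; _+_; _*_; _-_)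
  import Data.Integer.Properties as ZP
  import Data.Integer.Tactic.RingSolver as ZS

  monomial : ℕ → ℕ → ℕ → Poly3
  monomial k y f a b c = if (k ≡ᵇ a) ∧ ((y ≡ᵇ b) ∧ (f ≡ᵇ c)) then + 1 else + 0

  count≡ΣL : {A : Set} (p : A → Bool) (L : List A) → + countᵇ p L ≡ ΣL L (λ x → if p x then + 1 else + 0)
  count≡ΣL p [] = refl
  count≡ΣL p (x ∷ L) = trans (cong +_ (countᵇ-∷ p x L)) (cong₂ _+_ (b2n≡if (p x)) (count≡ΣL p L))
    where
    b2n≡if : ∀ b → + b2n b ≡ (if b then + 1 else + 0)
    b2n≡if true = refl
    b2n≡if false = refl

  P≡ΣL : ∀ n a b c → P n a b c ≡ ΣL (perms n) (λ π → monomial (cpk π) (cyc π) (fix π) a b c)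
  P≡ΣL n a b c = count≡ΣL _ (perms n)

  SumOf : {A : Set} → List A → Poly3 → (A → Poly3) → Set
  SumOf L H Φ = ∀ a b c → H a b c ≡ ΣL L (λ π → Φ π a b c)

  module _ {A : Set} (L : List A) where
    mulQ-SumOf : ∀ {H Φ} → SumOf L H Φ → SumOf L (mulQ H) (λ π → mulQ (Φ π))
    mulQ-SumOf h zero b c = ΣL-zero L
    mulQ-SumOf h (suc a) b c = h a b c

    mulX-SumOf : ∀ {H Φ} → SumOf L H Φ → SumOf L (mulX H) (λ π → mulX (Φ π))
    mulX-SumOf h a zero c = ΣL-zero L
    mulX-SumOf h a (suc b) c = h a b c

    mulY-SumOf : ∀ {H Φ} → SumOf L H Φ → SumOf L (mulY H) (λ π → mulY (Φ π))
    mulY-SumOf h a b zero = ΣL-zero L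
    mulY-SumOf h a b (suc c) = h a b c

    ∂q-SumOf : ∀ {H Φ} → SumOf L H Φ → SumOf L (∂q H) (λ π → ∂q (Φ π))
    ∂q-SumOf {Φ = Φ} h a b c = trans (cong (+ suc a *_) (h (suc a) b c)) (ΣL-scale L (+ suc a) (λ π → Φ π (suc a) b c))

    ∂x-SumOf : ∀ {H Φ} → SumOf L H Φ → SumOf L (∂x H) (λ π → ∂x (Φ π))
    ∂x-SumOf {Φ = Φ} h a b c = trans (cong (+ suc b *_) (h a (suc b) c)) (ΣL-scale L (+ suc b) (λ π → Φ π a (suc b) c))

    ∂y-SumOf : ∀ {H Φ} → SumOf L H Φ → SumOf L (∂y H) (λ π → ∂y (Φ π))
    ∂y-SumOf {Φ = Φ} h a b c = trans (cong (+ suc c *_) (h a b (suc c))) (ΣL-scale L (+ suc c) (λ π → Φ π a b (suc c)))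

  -- RHS3 n F a b c is definitionally rhs3Terms (+ n) applied to the coefficients at (a, b, c)
  -- of the eight polynomials occurring in RHS3, in order; similarly for rhs2Terms.
  rhs3Terms : ℤ → ℤ → ℤ → ℤ → ℤ → ℤ → ℤ → ℤ → ℤ → ℤ
  rhs3Terms m A B C D E F G H = ((m * A + B) + + 2 * (C - D)) + ((E - F) + (G - H))

  rhs3Terms-+ : ∀ (m A B C D E F G H A' B' C' D' E' F' G' H' : ℤ) →
    rhs3Terms m (A + A') (B + B') (C + C') (D + D') (E + E') (F + F') (G + G') (H + H') ≡ rhs3Terms m A B C D E F G H + rhs3Terms m A' B' C' D' E' F' G' H'
  rhs3Terms-+ = rearrange
    where
    rearrange : ∀ (m A B C D E F G H A' B' C' D' E' F' G' H' : ℤ) →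
      ((m * (A + A') + (B + B')) + + 2 * ((C + C') - (D + D'))) + (((E + E') - (F + F')) + ((G + G') - (H + H'))) ≡
      (((m * A + B) + + 2 * (C - D)) + ((E - F) + (G - H))) + (((m * A' + B') + + 2 * (C' - D')) + ((E' - F') + (G' - H')))
    rearrange = ZS.solve-∀

  rhs3Terms-0 : ∀ (m : ℤ) → rhs3Terms m +0 +0 +0 +0 +0 +0 +0 +0 ≡ +0
  rhs3Terms-0 m = rearrange m
    where
    rearrange : ∀ (m : ℤ) → ((m * +0 + +0) + + 2 * (+0 - +0)) + ((+0 - +0) + (+0 - +0)) ≡ +0
    rearrange = ZS.solve-∀

  rhs3Terms-ΣL : {A : Set} (L : List A) (m : ℤ) (a1 a2 a3 a4 a5 a6 a7 a8 : A → ℤ) →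
    rhs3Terms m (ΣL L a1) (ΣL L a2) (ΣL L a3) (ΣL L a4) (ΣL L a5) (ΣL L a6) (ΣL L a7) (ΣL L a8) ≡
    ΣL L (λ x → rhs3Terms m (a1 x) (a2 x) (a3 x) (a4 x) (a5 x) (a6 x) (a7 x) (a8 x))
  rhs3Terms-ΣL [] m a1 a2 a3 a4 a5 a6 a7 a8 = rhs3Terms-0 m
  rhs3Terms-ΣL (x ∷ L) m a1 a2 a3 a4 a5 a6 a7 a8 =
    trans (rhs3Terms-+ m (a1 x) (a2 x) (a3 x) (a4 x) (a5 x) (a6 x) (a7 x) (a8 x) _ _ _ _ _ _ _ _)
             (cong (_+_ (rhs3Terms m (a1 x) (a2 x) (a3 x) (a4 x) (a5 x) (a6 x) (a7 x) (a8 x))) (rhs3Terms-ΣL L m a1 a2 a3 a4 a5 a6 a7 a8))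

  RHS3-ΣL : {A : Set} (L : List A) (n : ℕ) {H : Poly3} {Φ : A → Poly3} → SumOf L H Φ → ∀ a b c → RHS3 n H a b c ≡ ΣL L (λ π → RHS3 n (Φ π) a b c)
  RHS3-ΣL L n h a b c = trans
    (cong₂ (λ u v → u + v)
      (cong₂ (λ u v → u + v) (cong₂ (λ u v → + n * u + v) (mulQ-SumOf L h a b c) (mulX-SumOf L (mulY-SumOf L h) a b c))
                              (cong (+ 2 *_) (cong₂ _-_ (mulQ-SumOf L (∂q-SumOf L h) a b c) (mulQ-SumOf L (mulQ-SumOf L (∂q-SumOf L h)) a b c))))
      (cong₂ _+_ (cong₂ _-_ (mulX-SumOf L (∂x-SumOf L h) a b c) (mulQ-SumOf L (mulX-SumOf L (∂x-SumOf L h)) a b c))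
                 (cong₂ _-_ (∂y-SumOf L h a b c) (mulY-SumOf L (∂y-SumOf L h) a b c))))
    (rhs3Terms-ΣL L (+ n) _ _ _ _ _ _ _ _)

  ScaledBy : Poly3 → ℤ → Poly3 → Set
  ScaledBy H m G = ∀ a b c → H a b c ≡ m * G a b c

  0≡m*0 : ∀ (m : ℤ) → +0 ≡ m * +0
  0≡m*0 m = sym (ZP.*-zeroʳ m)

  coef-q : ∀ (g : ℕ → ℤ) k y f a b c → g a * monomial k y f a b c ≡ g k * monomial k y f a b c
  coef-q g k y f a b c with k ≡ᵇ a in e
  ... | false = trans (ZP.*-zeroʳ (g a)) (sym (ZP.*-zeroʳ (g k)))
  ... | true = cong₂ _*_ (cong g (sym (≡ᵇ-true⇒≡ e))) refl

  coef-x : ∀ (g : ℕ → ℤ) k y f a b c → g b * monomial k y f a b c ≡ g y * monomial k y f a b c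
  coef-x g k y f a b c with k ≡ᵇ a
  ... | false = trans (ZP.*-zeroʳ (g b)) (sym (ZP.*-zeroʳ (g y)))
  ... | true with y ≡ᵇ b in e
  ...   | false = trans (ZP.*-zeroʳ (g b)) (sym (ZP.*-zeroʳ (g y)))
  ...   | true = cong₂ _*_ (cong g (sym (≡ᵇ-true⇒≡ e))) refl

  coef-y : ∀ (g : ℕ → ℤ) k y f a b c → g c * monomial k y f a b c ≡ g f * monomial k y f a b c
  coef-y g k y f a b c with k ≡ᵇ a
  ... | false = trans (ZP.*-zeroʳ (g c)) (sym (ZP.*-zeroʳ (g f)))
  ... | true with y ≡ᵇ b
  ...   | false = trans (ZP.*-zeroʳ (g c)) (sym (ZP.*-zeroʳ (g f)))
  ...   | true with f ≡ᵇ c in e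
  ...     | false = trans (ZP.*-zeroʳ (g c)) (sym (ZP.*-zeroʳ (g f)))
  ...     | true = cong₂ _*_ (cong g (sym (≡ᵇ-true⇒≡ e))) refl

  module _ {k y f : ℕ} where
    mulQ-ScaledBy : ∀ {H m} → ScaledBy H m (monomial k y f) → ScaledBy (mulQ H) m (monomial (suc k) y f)
    mulQ-ScaledBy {m = m} h zero b c = 0≡m*0 m
    mulQ-ScaledBy h (suc a) b c = h a b c

    mulX-ScaledBy : ∀ {H m} → ScaledBy H m (monomial k y f) → ScaledBy (mulX H) m (monomial k (suc y) f)
    mulX-ScaledBy {m = m} h a zero c with k ≡ᵇ a
    ... | true = 0≡m*0 m
    ... | false = 0≡m*0 m
    mulX-ScaledBy h a (suc b) c = h a b c

    mulY-ScaledBy : ∀ {H m} → ScaledBy H m (monomial k y f) → ScaledBy (mulY H) m (monomial k y (suc f))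
    mulY-ScaledBy {m = m} h a b zero with k ≡ᵇ a
    ... | false = 0≡m*0 m
    ... | true with y ≡ᵇ b
    ...   | true = 0≡m*0 m
    ...   | false = 0≡m*0 m
    mulY-ScaledBy h a b (suc c) = h a b c

    private
      swap-scalar : ∀ (u m I : ℤ) → u * (m * I) ≡ m * (u * I)
      swap-scalar = ZS.solve-∀
      assoc-scalar : ∀ (m u I : ℤ) → m * (u * I) ≡ (m * u) * I
      assoc-scalar = ZS.solve-∀

    mulQ∂q-ScaledBy : ∀ {H m} → ScaledBy H m (monomial k y f) → ScaledBy (mulQ (∂q H)) (m * + k) (monomial k y f)
    mulQ∂q-ScaledBy {H} {m} h zero b c = begin
      +0 ≡⟨ 0≡m*0 m ⟩
      m * +0 ≡⟨ cong (m *_) (sym (ZP.*-zeroˡ (monomial k y f 0 b c))) ⟩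
      m * (+ 0 * monomial k y f 0 b c) ≡⟨ cong (m *_) (coef-q +_ k y f 0 b c) ⟩
      m * (+ k * monomial k y f 0 b c) ≡⟨ assoc-scalar m (+ k) _ ⟩
      (m * + k) * monomial k y f 0 b c ∎
    mulQ∂q-ScaledBy {H} {m} h (suc a) b c = begin
      + suc a * H (suc a) b c ≡⟨ cong (+ suc a *_) (h (suc a) b c) ⟩
      + suc a * (m * monomial k y f (suc a) b c) ≡⟨ swap-scalar (+ suc a) m _ ⟩
      m * (+ suc a * monomial k y f (suc a) b c) ≡⟨ cong (m *_) (coef-q +_ k y f (suc a) b c) ⟩
      m * (+ k * monomial k y f (suc a) b c) ≡⟨ assoc-scalar m (+ k) _ ⟩
      (m * + k) * monomial k y f (suc a) b c ∎

    mulX∂x-ScaledBy : ∀ {H m} → ScaledBy H m (monomial k y f) → ScaledBy (mulX (∂x H)) (m * + y) (monomial k y f)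
    mulX∂x-ScaledBy {H} {m} h a zero c = begin
      +0 ≡⟨ 0≡m*0 m ⟩
      m * +0 ≡⟨ cong (m *_) (sym (ZP.*-zeroˡ (monomial k y f a 0 c))) ⟩
      m * (+ 0 * monomial k y f a 0 c) ≡⟨ cong (m *_) (coef-x +_ k y f a 0 c) ⟩
      m * (+ y * monomial k y f a 0 c) ≡⟨ assoc-scalar m (+ y) _ ⟩
      (m * + y) * monomial k y f a 0 c ∎
    mulX∂x-ScaledBy {H} {m} h a (suc b) c = begin
      + suc b * H a (suc b) c ≡⟨ cong (+ suc b *_) (h a (suc b) c) ⟩
      + suc b * (m * monomial k y f a (suc b) c) ≡⟨ swap-scalar (+ suc b) m _ ⟩
      m * (+ suc b * monomial k y f a (suc b) c) ≡⟨ cong (m *_) (coef-x +_ k y f a (suc b) c) ⟩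
      m * (+ y * monomial k y f a (suc b) c) ≡⟨ assoc-scalar m (+ y) _ ⟩
      (m * + y) * monomial k y f a (suc b) c ∎

    mulY∂y-ScaledBy : ∀ {H m} → ScaledBy H m (monomial k y f) → ScaledBy (mulY (∂y H)) (m * + f) (monomial k y f)
    mulY∂y-ScaledBy {H} {m} h a b zero = begin
      +0 ≡⟨ 0≡m*0 m ⟩
      m * +0 ≡⟨ cong (m *_) (sym (ZP.*-zeroˡ (monomial k y f a b 0))) ⟩
      m * (+ 0 * monomial k y f a b 0) ≡⟨ cong (m *_) (coef-y +_ k y f a b 0) ⟩
      m * (+ f * monomial k y f a b 0) ≡⟨ assoc-scalar m (+ f) _ ⟩
      (m * + f) * monomial k y f a b 0 ∎
    mulY∂y-ScaledBy {H} {m} h a b (suc c) = begin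
      + suc c * H a b (suc c) ≡⟨ cong (+ suc c *_) (h a b (suc c)) ⟩
      + suc c * (m * monomial k y f a b (suc c)) ≡⟨ swap-scalar (+ suc c) m _ ⟩
      m * (+ suc c * monomial k y f a b (suc c)) ≡⟨ cong (m *_) (coef-y +_ k y f a b (suc c)) ⟩
      m * (+ f * monomial k y f a b (suc c)) ≡⟨ assoc-scalar m (+ f) _ ⟩
      (m * + f) * monomial k y f a b (suc c) ∎

    ∂y-ScaledBy : ∀ {H m} → ScaledBy H m (monomial k y f) → ScaledBy (∂y H) (m * + f) (monomial k y (f ∸ 1))
    ∂y-ScaledBy {H} {m} h a b c = trans (cong (+ suc c *_) (h a b (suc c))) (trans (swap-scalar (+ suc c) m _) (trans (cong (m *_) (shift-exponent f)) (assoc-scalar m (+ f) _)))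
      where
      shift-exponent : ∀ f → + suc c * monomial k y f a b (suc c) ≡ + f * monomial k y (f ∸ 1) a b c
      shift-exponent zero = trans (coef-y (λ z → + z) k y 0 a b (suc c)) (trans (ZP.*-zeroˡ (monomial k y 0 a b (suc c))) (sym (ZP.*-zeroˡ (monomial k y 0 a b c))))
      shift-exponent (suc f') = coef-y (λ z → + suc z) k y f' a b c

  rhs3Terms-cong : ∀ {m A B C D E F G H A' B' C' D' E' F' G' H'} → A ≡ A' → B ≡ B' → C ≡ C' → D ≡ D' → E ≡ E' → F ≡ F' → G ≡ G' → H ≡ H' →
    rhs3Terms m A B C D E F G H ≡ rhs3Terms m A' B' C' D' E' F' G' H'
  rhs3Terms-cong refl refl refl refl refl refl refl refl = refl

  RHS3-monomial-terms : ∀ n k y f a b c → RHS3 n (monomial k y f) a b c ≡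
    rhs3Terms (+ n) (+ 1 * monomial (suc k) y f a b c) (+ 1 * monomial k (suc y) (suc f) a b c)
         ((+ 1 * + k) * monomial k y f a b c) ((+ 1 * + k) * monomial (suc k) y f a b c)
         ((+ 1 * + y) * monomial k y f a b c) ((+ 1 * + y) * monomial (suc k) y f a b c)
         ((+ 1 * + f) * monomial k y (f ∸ 1) a b c) ((+ 1 * + f) * monomial k y f a b c)
  RHS3-monomial-terms n k y f a b c = rhs3Terms-cong {+ n}
    (mulQ-ScaledBy {k} {y} {f} {I} {+ 1} base a b c)
    (mulX-ScaledBy {k} {y} {suc f} {mulY I} {+ 1} (mulY-ScaledBy {k} {y} {f} {I} {+ 1} base) a b c)
    (mulQ∂q-ScaledBy {k} {y} {f} {I} {+ 1} base a b c)
    (mulQ-ScaledBy {k} {y} {f} {mulQ (∂q I)} {+ 1 * + k} (mulQ∂q-ScaledBy {k} {y} {f} {I} {+ 1} base) a b c)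
    (mulX∂x-ScaledBy {k} {y} {f} {I} {+ 1} base a b c)
    (mulQ-ScaledBy {k} {y} {f} {mulX (∂x I)} {+ 1 * + y} (mulX∂x-ScaledBy {k} {y} {f} {I} {+ 1} base) a b c)
    (∂y-ScaledBy {k} {y} {f} {I} {+ 1} base a b c)
    (mulY∂y-ScaledBy {k} {y} {f} {I} {+ 1} base a b c)
    where
    I = monomial k y f
    base : ScaledBy (monomial k y f) (+ 1) (monomial k y f)
    base a b c = sym (ZP.*-identityˡ _)

  +≡⇒≡- : ∀ (a e x : ℤ) → a + e ≡ x → e ≡ x - a
  +≡⇒≡- a e x h = begin
    e ≡⟨ rearrange a e ⟩
    (a + e) - a ≡⟨ cong (_- a) h ⟩
    x - a ∎
    where
    rearrange : ∀ (a e : ℤ) → e ≡ (a + e) - a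
    rearrange = ZS.solve-∀

  rhs3-collect : ∀ (D y k f qμ xyμ μ μ/y : ℤ) →
    (((D + y + + 2 * k) * (+ 1 * qμ) + + 1 * xyμ) + + 2 * ((+ 1 * k) * μ - (+ 1 * k) * qμ))
      + (((+ 1 * y) * μ - (+ 1 * y) * qμ) + ((+ 1 * f) * μ/y - (+ 1 * f) * μ))
    ≡ (f * μ/y + (D * qμ + ((D + y + + 2 * k) - (f + D)) * μ)) + xyμ
  rhs3-collect = ZS.solve-∀

  RHS3-monomial : ∀ n k y f D E a b c → D ℕ.+ y ℕ.+ 2 ℕ.* k ≡ n → f ℕ.+ D ℕ.+ E ≡ n →
    RHS3 n (monomial k y f) a b c ≡ (+ f * monomial k y (f ∸ 1) a b c + (+ D * monomial (suc k) y f a b c + + E * monomial k y f a b c)) + monomial k (y ℕ.+ 1) (f ℕ.+ 1) a b c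
  RHS3-monomial n k y f D E a b c e1 e2 = begin
    RHS3 n (monomial k y f) a b c ≡⟨ RHS3-monomial-terms n k y f a b c ⟩
    rhs3Terms (+ n) (+ 1 * qμ) (+ 1 * xyμ) ((+ 1 * + k) * μ) ((+ 1 * + k) * qμ) ((+ 1 * + y) * μ) ((+ 1 * + y) * qμ) ((+ 1 * + f) * μ/y) ((+ 1 * + f) * μ)
      ≡⟨ cong (λ z → rhs3Terms z (+ 1 * qμ) (+ 1 * xyμ) ((+ 1 * + k) * μ) ((+ 1 * + k) * qμ) ((+ 1 * + y) * μ) ((+ 1 * + y) * qμ) ((+ 1 * + f) * μ/y) ((+ 1 * + f) * μ)) n≡n′ ⟩
    rhs3Terms n′ (+ 1 * qμ) (+ 1 * xyμ) ((+ 1 * + k) * μ) ((+ 1 * + k) * qμ) ((+ 1 * + y) * μ) ((+ 1 * + y) * qμ) ((+ 1 * + f) * μ/y) ((+ 1 * + f) * μ)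
      ≡⟨ rhs3-collect (+ D) (+ y) (+ k) (+ f) qμ xyμ μ μ/y ⟩
    (+ f * μ/y + (+ D * qμ + (n′ - (+ f + + D)) * μ)) + xyμ
      ≡⟨ cong₂ (λ u v → (+ f * μ/y + (+ D * qμ + u * μ)) + v) (sym E≡) xyμ≡ ⟩
    (+ f * μ/y + (+ D * qμ + + E * μ)) + monomial k (y ℕ.+ 1) (f ℕ.+ 1) a b c ∎
    where
    qμ = monomial (suc k) y f a b c
    xyμ = monomial k (suc y) (suc f) a b c
    μ = monomial k y f a b c
    μ/y = monomial k y (f ∸ 1) a b c
    n′ : ℤ
    n′ = + D + + y + + 2 * + k
    n≡n′ : + n ≡ n′
    n≡n′ = trans (cong +_ (sym e1)) (cong (λ z → + D + + y + z) (ZP.pos-* 2 k))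
    E≡ : + E ≡ n′ - (+ f + + D)
    E≡ = +≡⇒≡- (+ f + + D) (+ E) n′ (trans (cong +_ e2) n≡n′)
    xyμ≡ : xyμ ≡ monomial k (y ℕ.+ 1) (f ℕ.+ 1) a b c
    xyμ≡ = cong₂ (λ u v → monomial k u v a b c) (NP.+-comm 1 y) (NP.+-comm 1 f)

  P-recurrence : ∀ n a b c → P (suc n) a b c ≡ RHS3 n (P n) a b c
  P-recurrence n a b c = begin
    P (suc n) a b c ≡⟨ P≡ΣL (suc n) a b c ⟩
    ΣL (perms (suc n)) (λ σ → w (cpk σ) (cyc σ) (fix σ)) ≡⟨ ΣL-perms-suc n w ⟩
    ΣL (perms n) (λ π → contribution n π w) ≡⟨ ΣL-cong (perms n) (λ {π} m → sym (RHS3-monomial n (cpk π) (cyc π) (fix π) (raisingCount n π) (neutralCount n π) a b c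
                                        (proj₁ (counting-identities n m)) (proj₁ (proj₂ (counting-identities n m))))) ⟩
    ΣL (perms n) (λ π → RHS3 n (monomial (cpk π) (cyc π) (fix π)) a b c) ≡⟨ sym (RHS3-ΣL (perms n) n (P≡ΣL n) a b c) ⟩
    RHS3 n (P n) a b c ∎
    where
    w : ℕ → ℕ → ℕ → ℤ
    w k y f = monomial k y f a b c

  monomial₂ : ℕ → ℕ → Poly2
  monomial₂ k y a b = if (k ≡ᵇ a) ∧ (y ≡ᵇ b) then + 1 else + 0

  δ : ℕ → ℕ → ℤ
  δ f c = if f ≡ᵇ c then + 1 else + 0

  monomial-split : ∀ k y f a b c → monomial k y f a b c ≡ monomial₂ k y a b * δ f c
  monomial-split k y f a b c with k ≡ᵇ a
  ... | false = refl
  ... | true with y ≡ᵇ b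
  ...   | false = refl
  ...   | true with f ≡ᵇ c
  ...     | true = refl
  ...     | false = refl

  sumTo-cong : ∀ d {g h : ℕ → ℤ} → (∀ c → g c ≡ h c) → sumTo d g ≡ sumTo d h
  sumTo-cong zero e = e 0
  sumTo-cong (suc d) e = cong₂ _+_ (sumTo-cong d e) (e (suc d))

  sumTo-scale : ∀ d (m : ℤ) (g : ℕ → ℤ) → sumTo d (λ c → m * g c) ≡ m * sumTo d g
  sumTo-scale zero m g = refl
  sumTo-scale (suc d) m g = trans (cong (_+ m * g (suc d)) (sumTo-scale d m g)) (sym (ZP.*-distribˡ-+ m _ _))

  sumTo-δ0 : ∀ d f → d < f → sumTo d (δ f) ≡ +0
  sumTo-δ0 zero f lt rewrite ≢⇒≡ᵇ-false {f} {0} (λ e → NP.<-irrefl (sym e) lt) = refl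
  sumTo-δ0 (suc d) f lt rewrite ≢⇒≡ᵇ-false {f} {suc d} (λ e → NP.<-irrefl (sym e) lt) =
    trans (ZP.+-identityʳ _) (sumTo-δ0 d f (NP.<-trans (NP.n<1+n d) lt))

  sumTo-δ : ∀ d f → f ≤ d → sumTo d (δ f) ≡ + 1
  sumTo-δ zero zero _ = refl
  sumTo-δ (suc d) f le with NP.m≤n⇒m<n∨m≡n le
  ... | inj₁ lt rewrite ≢⇒≡ᵇ-false {f} {suc d} (λ e → NP.<-irrefl e lt) = trans (ZP.+-identityʳ _) (sumTo-δ d f (NP.≤-pred lt))
  ... | inj₂ refl rewrite ≡ᵇ-refl d = cong (_+ + 1) (sumTo-δ0 d (suc d) (NP.n<1+n d))

  sumTo-Ind : ∀ d k y f a b → f ≤ d → sumTo d (λ c → monomial k y f a b c) ≡ monomial₂ k y a b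
  sumTo-Ind d k y f a b le = begin
    sumTo d (λ c → monomial k y f a b c) ≡⟨ sumTo-cong d (monomial-split k y f a b) ⟩
    sumTo d (λ c → monomial₂ k y a b * δ f c) ≡⟨ sumTo-scale d (monomial₂ k y a b) (δ f) ⟩
    monomial₂ k y a b * sumTo d (δ f) ≡⟨ cong (monomial₂ k y a b *_) (sumTo-δ d f le) ⟩
    monomial₂ k y a b * + 1 ≡⟨ ZP.*-identityʳ _ ⟩
    monomial₂ k y a b ∎

  sumTo-ΣL : {A : Set} (L : List A) (d : ℕ) (g : ℕ → A → ℤ) → sumTo d (λ c → ΣL L (g c)) ≡ ΣL L (λ π → sumTo d (λ c → g c π))
  sumTo-ΣL L zero g = refl
  sumTo-ΣL L (suc d) g = trans (cong (_+ ΣL L (g (suc d))) (sumTo-ΣL L d g)) (sym (ΣL-+ L _ _))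

  P1≡ΣL : ∀ m → (∀ {π} → π ∈ perms m → fix π ≤ m) → ∀ a b → P1 m a b ≡ ΣL (perms m) (λ π → monomial₂ (cpk π) (cyc π) a b)
  P1≡ΣL m isFixed a b = begin
    sumTo m (P m a b) ≡⟨ sumTo-cong m (P≡ΣL m a b) ⟩
    sumTo m (λ c → ΣL (perms m) (λ π → monomial (cpk π) (cyc π) (fix π) a b c)) ≡⟨ sumTo-ΣL (perms m) m _ ⟩
    ΣL (perms m) (λ π → sumTo m (λ c → monomial (cpk π) (cyc π) (fix π) a b c)) ≡⟨ ΣL-cong (perms m) (λ {π} mm → sumTo-Ind m (cpk π) (cyc π) (fix π) a b (isFixed mm)) ⟩
    ΣL (perms m) (λ π → monomial₂ (cpk π) (cyc π) a b) ∎

  SumOf₂ : {A : Set} → List A → Poly2 → (A → Poly2) → Set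
  SumOf₂ L H Φ = ∀ a b → H a b ≡ ΣL L (λ π → Φ π a b)

  module _ {A : Set} (L : List A) where
    mulQ₂-SumOf : ∀ {H Φ} → SumOf₂ L H Φ → SumOf₂ L (mulQ₂ H) (λ π → mulQ₂ (Φ π))
    mulQ₂-SumOf h zero b = ΣL-zero L
    mulQ₂-SumOf h (suc a) b = h a b

    mulX₂-SumOf : ∀ {H Φ} → SumOf₂ L H Φ → SumOf₂ L (mulX₂ H) (λ π → mulX₂ (Φ π))
    mulX₂-SumOf h a zero = ΣL-zero L
    mulX₂-SumOf h a (suc b) = h a b

    ∂q₂-SumOf : ∀ {H Φ} → SumOf₂ L H Φ → SumOf₂ L (∂q₂ H) (λ π → ∂q₂ (Φ π))
    ∂q₂-SumOf {Φ = Φ} h a b = trans (cong (+ suc a *_) (h (suc a) b)) (ΣL-scale L (+ suc a) (λ π → Φ π (suc a) b))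

    ∂x₂-SumOf : ∀ {H Φ} → SumOf₂ L H Φ → SumOf₂ L (∂x₂ H) (λ π → ∂x₂ (Φ π))
    ∂x₂-SumOf {Φ = Φ} h a b = trans (cong (+ suc b *_) (h a (suc b))) (ΣL-scale L (+ suc b) (λ π → Φ π a (suc b)))

  rhs2Terms : ℤ → ℤ → ℤ → ℤ → ℤ → ℤ → ℤ → ℤ
  rhs2Terms m A B C D E F = ((m * A + B) + + 2 * (C - D)) + (E - F)

  rhs2Terms-+ : ∀ (m A B C D E F A' B' C' D' E' F' : ℤ) →
    rhs2Terms m (A + A') (B + B') (C + C') (D + D') (E + E') (F + F') ≡ rhs2Terms m A B C D E F + rhs2Terms m A' B' C' D' E' F'
  rhs2Terms-+ = rearrange
    where
    rearrange : ∀ (m A B C D E F A' B' C' D' E' F' : ℤ) →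
      ((m * (A + A') + (B + B')) + + 2 * ((C + C') - (D + D'))) + ((E + E') - (F + F')) ≡
      (((m * A + B) + + 2 * (C - D)) + (E - F)) + (((m * A' + B') + + 2 * (C' - D')) + (E' - F'))
    rearrange = ZS.solve-∀

  rhs2Terms-0 : ∀ (m : ℤ) → rhs2Terms m +0 +0 +0 +0 +0 +0 ≡ +0
  rhs2Terms-0 m = rearrange m
    where
    rearrange : ∀ (m : ℤ) → ((m * +0 + +0) + + 2 * (+0 - +0)) + (+0 - +0) ≡ +0
    rearrange = ZS.solve-∀

  rhs2Terms-ΣL : {A : Set} (L : List A) (m : ℤ) (a1 a2 a3 a4 a5 a6 : A → ℤ) →
    rhs2Terms m (ΣL L a1) (ΣL L a2) (ΣL L a3) (ΣL L a4) (ΣL L a5) (ΣL L a6) ≡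
    ΣL L (λ x → rhs2Terms m (a1 x) (a2 x) (a3 x) (a4 x) (a5 x) (a6 x))
  rhs2Terms-ΣL [] m a1 a2 a3 a4 a5 a6 = rhs2Terms-0 m
  rhs2Terms-ΣL (x ∷ L) m a1 a2 a3 a4 a5 a6 =
    trans (rhs2Terms-+ m (a1 x) (a2 x) (a3 x) (a4 x) (a5 x) (a6 x) _ _ _ _ _ _)
             (cong (_+_ (rhs2Terms m (a1 x) (a2 x) (a3 x) (a4 x) (a5 x) (a6 x))) (rhs2Terms-ΣL L m a1 a2 a3 a4 a5 a6))

  RHS2-ΣL : {A : Set} (L : List A) (n : ℕ) {H : Poly2} {Φ : A → Poly2} → SumOf₂ L H Φ → ∀ a b → RHS2 n H a b ≡ ΣL L (λ π → RHS2 n (Φ π) a b)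
  RHS2-ΣL L n h a b = trans
    (cong₂ (λ u v → u + v)
      (cong₂ (λ u v → u + v) (cong₂ (λ u v → + n * u + v) (mulQ₂-SumOf L h a b) (mulX₂-SumOf L h a b))
                              (cong (+ 2 *_) (cong₂ _-_ (mulQ₂-SumOf L (∂q₂-SumOf L h) a b) (mulQ₂-SumOf L (mulQ₂-SumOf L (∂q₂-SumOf L h)) a b))))
      (cong₂ _-_ (mulX₂-SumOf L (∂x₂-SumOf L h) a b) (mulQ₂-SumOf L (mulX₂-SumOf L (∂x₂-SumOf L h)) a b)))
    (rhs2Terms-ΣL L (+ n) _ _ _ _ _ _)

  ScaledBy₂ : Poly2 → ℤ → Poly2 → Set
  ScaledBy₂ H m G = ∀ a b → H a b ≡ m * G a b

  coef-q₂ : ∀ (g : ℕ → ℤ) k y a b → g a * monomial₂ k y a b ≡ g k * monomial₂ k y a b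
  coef-q₂ g k y a b with k ≡ᵇ a in e
  ... | false = trans (ZP.*-zeroʳ (g a)) (sym (ZP.*-zeroʳ (g k)))
  ... | true = cong₂ _*_ (cong g (sym (≡ᵇ-true⇒≡ e))) refl

  coef-x₂ : ∀ (g : ℕ → ℤ) k y a b → g b * monomial₂ k y a b ≡ g y * monomial₂ k y a b
  coef-x₂ g k y a b with k ≡ᵇ a
  ... | false = trans (ZP.*-zeroʳ (g b)) (sym (ZP.*-zeroʳ (g y)))
  ... | true with y ≡ᵇ b in e
  ...   | false = trans (ZP.*-zeroʳ (g b)) (sym (ZP.*-zeroʳ (g y)))
  ...   | true = cong₂ _*_ (cong g (sym (≡ᵇ-true⇒≡ e))) refl

  module _ {k y : ℕ} where
    mulQ₂-ScaledBy : ∀ {H m} → ScaledBy₂ H m (monomial₂ k y) → ScaledBy₂ (mulQ₂ H) m (monomial₂ (suc k) y)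
    mulQ₂-ScaledBy {m = m} h zero b = 0≡m*0 m
    mulQ₂-ScaledBy h (suc a) b = h a b

    mulX₂-ScaledBy : ∀ {H m} → ScaledBy₂ H m (monomial₂ k y) → ScaledBy₂ (mulX₂ H) m (monomial₂ k (suc y))
    mulX₂-ScaledBy {m = m} h a zero with k ≡ᵇ a
    ... | true = 0≡m*0 m
    ... | false = 0≡m*0 m
    mulX₂-ScaledBy h a (suc b) = h a b

    private
      swap-scalar : ∀ (u m I : ℤ) → u * (m * I) ≡ m * (u * I)
      swap-scalar = ZS.solve-∀
      assoc-scalar : ∀ (m u I : ℤ) → m * (u * I) ≡ (m * u) * I
      assoc-scalar = ZS.solve-∀

    mulQ∂q₂-ScaledBy : ∀ {H m} → ScaledBy₂ H m (monomial₂ k y) → ScaledBy₂ (mulQ₂ (∂q₂ H)) (m * + k) (monomial₂ k y)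
    mulQ∂q₂-ScaledBy {H} {m} h zero b = begin
      +0 ≡⟨ 0≡m*0 m ⟩
      m * +0 ≡⟨ cong (m *_) (sym (ZP.*-zeroˡ (monomial₂ k y 0 b))) ⟩
      m * (+ 0 * monomial₂ k y 0 b) ≡⟨ cong (m *_) (coef-q₂ +_ k y 0 b) ⟩
      m * (+ k * monomial₂ k y 0 b) ≡⟨ assoc-scalar m (+ k) _ ⟩
      (m * + k) * monomial₂ k y 0 b ∎
    mulQ∂q₂-ScaledBy {H} {m} h (suc a) b = begin
      + suc a * H (suc a) b ≡⟨ cong (+ suc a *_) (h (suc a) b) ⟩
      + suc a * (m * monomial₂ k y (suc a) b) ≡⟨ swap-scalar (+ suc a) m _ ⟩
      m * (+ suc a * monomial₂ k y (suc a) b) ≡⟨ cong (m *_) (coef-q₂ +_ k y (suc a) b) ⟩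
      m * (+ k * monomial₂ k y (suc a) b) ≡⟨ assoc-scalar m (+ k) _ ⟩
      (m * + k) * monomial₂ k y (suc a) b ∎

    mulX∂x₂-ScaledBy : ∀ {H m} → ScaledBy₂ H m (monomial₂ k y) → ScaledBy₂ (mulX₂ (∂x₂ H)) (m * + y) (monomial₂ k y)
    mulX∂x₂-ScaledBy {H} {m} h a zero = begin
      +0 ≡⟨ 0≡m*0 m ⟩
      m * +0 ≡⟨ cong (m *_) (sym (ZP.*-zeroˡ (monomial₂ k y a 0))) ⟩
      m * (+ 0 * monomial₂ k y a 0) ≡⟨ cong (m *_) (coef-x₂ +_ k y a 0) ⟩
      m * (+ y * monomial₂ k y a 0) ≡⟨ assoc-scalar m (+ y) _ ⟩
      (m * + y) * monomial₂ k y a 0 ∎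
    mulX∂x₂-ScaledBy {H} {m} h a (suc b) = begin
      + suc b * H a (suc b) ≡⟨ cong (+ suc b *_) (h a (suc b)) ⟩
      + suc b * (m * monomial₂ k y a (suc b)) ≡⟨ swap-scalar (+ suc b) m _ ⟩
      m * (+ suc b * monomial₂ k y a (suc b)) ≡⟨ cong (m *_) (coef-x₂ +_ k y a (suc b)) ⟩
      m * (+ y * monomial₂ k y a (suc b)) ≡⟨ assoc-scalar m (+ y) _ ⟩
      (m * + y) * monomial₂ k y a (suc b) ∎

  rhs2Terms-cong : ∀ {m A B C D E F A' B' C' D' E' F'} → A ≡ A' → B ≡ B' → C ≡ C' → D ≡ D' → E ≡ E' → F ≡ F' →
    rhs2Terms m A B C D E F ≡ rhs2Terms m A' B' C' D' E' F'
  rhs2Terms-cong refl refl refl refl refl refl = refl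

  rhs2-collect : ∀ (D y k f qμ xμ μ : ℤ) →
    (((D + y + + 2 * k) * (+ 1 * qμ) + + 1 * xμ) + + 2 * ((+ 1 * k) * μ - (+ 1 * k) * qμ))
      + ((+ 1 * y) * μ - (+ 1 * y) * qμ)
    ≡ (f * μ + (D * qμ + ((D + y + + 2 * k) - (f + D)) * μ)) + xμ
  rhs2-collect = ZS.solve-∀

  RHS2-monomial : ∀ n k y f D E a b → D ℕ.+ y ℕ.+ 2 ℕ.* k ≡ n → f ℕ.+ D ℕ.+ E ≡ n →
    RHS2 n (monomial₂ k y) a b ≡ (+ f * monomial₂ k y a b + (+ D * monomial₂ (suc k) y a b + + E * monomial₂ k y a b)) + monomial₂ k (y ℕ.+ 1) a b
  RHS2-monomial n k y f D E a b e1 e2 = begin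
    RHS2 n (monomial₂ k y) a b ≡⟨ rhs2Terms-cong {+ n}
        (mulQ₂-ScaledBy {k} {y} {I} {+ 1} base a b)
        (mulX₂-ScaledBy {k} {y} {I} {+ 1} base a b)
        (mulQ∂q₂-ScaledBy {k} {y} {I} {+ 1} base a b)
        (mulQ₂-ScaledBy {k} {y} {mulQ₂ (∂q₂ I)} {+ 1 * + k} (mulQ∂q₂-ScaledBy {k} {y} {I} {+ 1} base) a b)
        (mulX∂x₂-ScaledBy {k} {y} {I} {+ 1} base a b)
        (mulQ₂-ScaledBy {k} {y} {mulX₂ (∂x₂ I)} {+ 1 * + y} (mulX∂x₂-ScaledBy {k} {y} {I} {+ 1} base) a b) ⟩
    rhs2Terms (+ n) (+ 1 * qμ) (+ 1 * xμ) ((+ 1 * + k) * μ) ((+ 1 * + k) * qμ) ((+ 1 * + y) * μ) ((+ 1 * + y) * qμ)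
      ≡⟨ cong (λ z → rhs2Terms z (+ 1 * qμ) (+ 1 * xμ) ((+ 1 * + k) * μ) ((+ 1 * + k) * qμ) ((+ 1 * + y) * μ) ((+ 1 * + y) * qμ)) n≡n′ ⟩
    rhs2Terms n′ (+ 1 * qμ) (+ 1 * xμ) ((+ 1 * + k) * μ) ((+ 1 * + k) * qμ) ((+ 1 * + y) * μ) ((+ 1 * + y) * qμ)
      ≡⟨ rhs2-collect (+ D) (+ y) (+ k) (+ f) qμ xμ μ ⟩
    (+ f * μ + (+ D * qμ + (n′ - (+ f + + D)) * μ)) + xμ
      ≡⟨ cong₂ (λ u v → (+ f * μ + (+ D * qμ + u * μ)) + v) (sym E≡) xμ≡ ⟩
    (+ f * μ + (+ D * qμ + + E * μ)) + monomial₂ k (y ℕ.+ 1) a b ∎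
    where
    I = monomial₂ k y
    base : ScaledBy₂ I (+ 1) I
    base a b = sym (ZP.*-identityˡ _)
    qμ = monomial₂ (suc k) y a b
    xμ = monomial₂ k (suc y) a b
    μ = monomial₂ k y a b
    n′ : ℤ
    n′ = + D + + y + + 2 * + k
    n≡n′ : + n ≡ n′
    n≡n′ = trans (cong +_ (sym e1)) (cong (λ z → + D + + y + z) (ZP.pos-* 2 k))
    E≡ : + E ≡ n′ - (+ f + + D)
    E≡ = +≡⇒≡- (+ f + + D) (+ E) n′ (trans (cong +_ e2) n≡n′)
    xμ≡ : xμ ≡ monomial₂ k (y ℕ.+ 1) a b
    xμ≡ = cong (λ u → monomial₂ k u a b) (NP.+-comm 1 y)

  P1-recurrence : ∀ n a b → P1 (suc n) a b ≡ RHS2 n (P1 n) a b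
  P1-recurrence n a b = begin
    P1 (suc n) a b ≡⟨ P1≡ΣL (suc n) (λ m → proj₂ (proj₂ (counting-identities (suc n) m))) a b ⟩
    ΣL (perms (suc n)) (λ σ → w (cpk σ) (cyc σ) (fix σ)) ≡⟨ ΣL-perms-suc n w ⟩
    ΣL (perms n) (λ π → contribution n π w) ≡⟨ ΣL-cong (perms n) (λ {π} m → sym (RHS2-monomial n (cpk π) (cyc π) (fix π) (raisingCount n π) (neutralCount n π) a b
                                        (proj₁ (counting-identities n m)) (proj₁ (proj₂ (counting-identities n m))))) ⟩
    ΣL (perms n) (λ π → RHS2 n (monomial₂ (cpk π) (cyc π)) a b) ≡⟨ sym (RHS2-ΣL (perms n) n (P1≡ΣL n (λ m → proj₂ (proj₂ (counting-identities n m)))) a b) ⟩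
    RHS2 n (P1 n) a b ∎
    where
    w : ℕ → ℕ → ℕ → ℤ
    w k y f = monomial₂ k y a b

open Recurrences

mainTheorem2 : (n : ℕ) → n ≥ 1 →
    ((a b c : ℕ) → P (suc n) a b c ≡ RHS3 n (P n) a b c)
    × ((a b : ℕ) → P1 (suc n) a b ≡ RHS2 n (P1 n) a b)
mainTheorem2 n _ = P-recurrence n , P1-recurrence n
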